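{- Let $q=2^k$ with $k\ge1$, let $n=4m$ with $m\ge1$, let $t,s\in\mathrm{GF}(q)$, and let $\alpha\in\mathrm{GF}(q^{2m})\setminus\mathrm{GF}(q)$. Then \[ F(n,t,s,\alpha)=\begin{cases} q^{2m-1}, & t=Tr_{q^{2m}}(\alpha),\\ 0, & t\neq Tr_{q^{2m}}(\alpha).\end{cases} \]
   Context: For $\gamma\in\mathrm{GF}(q^n)$, $Tr(\gamma)=\sum_{i=0}^{n-1}\gamma^{q^i}$ and $St(\gamma)=\sum_{0\le i<j<n}\gamma^{q^i}\gamma^{q^j}$. $Tr_{q^{2m}}$ is the trace from $\mathrm{GF}(q^{2m})$ to $\mathrm{GF}(q)$. For $\alpha\in\mathrm{GF}(q^{2m})$, $R_\alpha=\{\gamma\in\mathrm{GF}(q^n):\gamma^{q^{2m}}+\gamma=\alpha\}$, and $F(n,t,s,\alpha)=|\{\gamma\in R_\alpha: Tr(\gamma)=t,\ St(\gamma)=s\}|$. -}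

module Defs where

open import Level using (0ℓ)
open import Data.Nat as ℕ using (ℕ; zero; suc; _∸_)
open import Data.List using (List; length; filter)
open import Data.List.Membership.Propositional using (_∈_)
open import Data.List.Relation.Unary.Unique.Propositional using (Unique)
open import Data.Product using (_×_; _,_; ∃)
open import Relation.Nullary using (¬_; Dec; yes; no)
open import Relation.Nullary.Decidable using (_×-dec_)
open import Relation.Binary.PropositionalEquality using (_≡_)
open import Relation.Binary using (DecidableEquality)
open import Algebra.Structures using (IsCommutativeRing)

record FiniteField : Set₁ where
  infixl 6 _+_
  infixl 7 _*_
  field
    Carrier  : Set
    _+_ _*_  : Carrier → Carrier → Carrier
    -_       : Carrier → Carrier
    0# 1#    : Carrier
    isCommutativeRing : IsCommutativeRing _≡_ _+_ _*_ -_ 0# 1#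
    0≢1      : ¬ (0# ≡ 1#)
    inverse  : ∀ x → ¬ (x ≡ 0#) → ∃ λ y → x * y ≡ 1#
    _≟_      : DecidableEquality Carrier
    elements : List Carrier
    unique   : Unique elements
    complete : ∀ x → x ∈ elements
  order : ℕ
  order = length elements
  _^_ : Carrier → ℕ → Carrier
  x ^ zero  = 1#
  x ^ suc e = x * (x ^ e)
  sumTo : ℕ → (ℕ → Carrier) → Carrier
  sumTo zero    f = 0#
  sumTo (suc n) f = sumTo n f + f n
  count : {P : Carrier → Set} → (∀ x → Dec (P x)) → ℕ
  count P? = length (filter P? elements)
  module _ (q : ℕ) where
    -- x belongs to the subfield GF(q^d) (fixed points of x ↦ x^(q^d))
    InSub : ℕ → Carrier → Set
    InSub d x = x ^ (q ℕ.^ d) ≡ x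
    Tr : ℕ → Carrier → Carrier
    Tr n γ = sumTo n (λ i → γ ^ (q ℕ.^ i))
    St : ℕ → Carrier → Carrier
    St n γ = sumTo n (λ j → sumTo j (λ i → (γ ^ (q ℕ.^ i)) * (γ ^ (q ℕ.^ j))))
    F : ℕ → ℕ → Carrier → Carrier → Carrier → ℕ
    F m n t s α = count (λ γ → ((γ ^ (q ℕ.^ (2 ℕ.* m)) + γ) ≟ α)
                          ×-dec ((Tr n γ ≟ t) ×-dec (St n γ ≟ s)))

-- Write Q = q ^ (2 m), L = GF(Q) and tr for the trace from L to GF(q). The relative trace
-- trQ x = x ^ Q + x maps the field onto L with kernel L, so R_α = γ₀ + L for any γ₀ with
-- trQ γ₀ = α, and Tr = tr ∘ trQ equals tr α on all of R_α. For x in L, St (γ₀ + x) = St γ₀ + g x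
-- with g x = tr x ^ 2 + tr (α x), which is additive in characteristic 2. Since α ∉ GF(q), the trace
-- form is nondegenerate enough that tr (α x) does not vanish on the kernel of tr, so g maps L onto
-- GF(q) and each of its q fibres has Q / q = q ^ (2 m - 1) elements; when t = tr α, F counts one fibre.
-- The sizes of L and GF(q) come from |domain| = |kernel| |image| for trQ and tr together with the
-- bound on the number of roots of a polynomial.
module Submission where

open import Defs
open import Level using (0ℓ)
open import Algebra.Bundles using (CommutativeRing)
open import Algebra.Structures using (IsCommutativeRing)
open import Data.Empty using (⊥; ⊥-elim)
open import Data.Unit using (⊤; tt)
open import Data.Product using (_×_; _,_; proj₁; proj₂; ∃)
open import Data.Sum as Sum using (_⊎_; inj₁; inj₂)
open import Data.Nat as ℕ using (ℕ; zero; suc; _≤_; _<_; _∸_; z≤n; s≤s)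
import Data.Nat.Properties as ℕ
open import Data.List using (List; []; _∷_; filter; length; map; foldr)
open import Data.List.Properties using (filter-≐; filter-all; filter-none; filter-some; filter-accept; filter-reject)
open import Data.List.Relation.Unary.All as All using (All; []; _∷_)
open import Data.List.Relation.Unary.Any using (here; there; any?; satisfied)
open import Data.List.Relation.Unary.AllPairs using (_∷_)
open import Data.List.Relation.Unary.Unique.Propositional using (Unique)
import Data.List.Relation.Unary.Unique.Propositional.Properties as Unique
open import Data.List.Membership.Propositional using (_∈_; lose)
open import Data.List.Membership.Propositional.Properties using (∈-filter⁺; ∈-filter⁻; ∈-map⁺; ∈-map⁻)
open import Data.List.Membership.Propositional.Properties.WithK using (unique∧set⇒bag)
open import Data.List.Relation.Binary.BagAndSetEquality using (∼bag⇒↭)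
open import Data.List.Relation.Binary.Permutation.Propositional using (_↭_; ↭⇒↭ₛ)
open import Data.List.Relation.Binary.Permutation.Propositional.Properties using (↭-length; filter-↭)
open import Data.List.Relation.Binary.Permutation.Setoid.Properties using (foldr-commMonoid)
open import Data.List.Relation.Binary.Pointwise using (Pointwise-≡⇒≡)
import Data.List.Relation.Binary.Sublist.Propositional as Sublist
open import Data.List.Relation.Binary.Sublist.Propositional.Properties as Sublist using (length-mono-≤; to-≋)
open import Function using (_∘_; id)
open import Function.Bundles using (mk⇔)
open import Relation.Nullary using (¬_; Dec; yes; no; ¬?)
open import Relation.Nullary.Decidable using (map′; _×-dec_; decidable-stable)
open import Relation.Unary using (Pred; Decidable; _⊆_; _≐_)
open import Relation.Unary.Properties using (_∪?_; _∩?_)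
open import Relation.Binary.PropositionalEquality
  using (_≡_; refl; sym; trans; cong; cong₂; subst; setoid; module ≡-Reasoning)

module _ {A : Set} {P Q : Pred A 0ℓ} (P? : Decidable P) (Q? : Decidable Q) where

  filter-⊆ : P ⊆ Q → ∀ xs → filter P? xs Sublist.⊆ filter Q? xs
  filter-⊆ P⊆Q xs = Sublist.filter⁺ P? Q? (λ { refl → P⊆Q }) (Sublist.⊆-refl {x = xs})

  length-filter-mono : P ⊆ Q → ∀ xs → length (filter P? xs) ≤ length (filter Q? xs)
  length-filter-mono P⊆Q xs = length-mono-≤ (filter-⊆ P⊆Q xs)

  length-filter-cong : P ≐ Q → ∀ xs → length (filter P? xs) ≡ length (filter Q? xs)
  length-filter-cong P≐Q xs = cong length (filter-≐ P? Q? P≐Q xs)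

  ⊇-by-length-filter : P ⊆ Q → ∀ xs → length (filter Q? xs) ≤ length (filter P? xs) →
                       ∀ {x} → x ∈ xs → Q x → P x
  ⊇-by-length-filter P⊆Q xs ≤P {x} x∈ Qx =
    proj₂ (∈-filter⁻ P? {xs = xs} (subst (x ∈_) (sym filterP≡filterQ) (∈-filter⁺ Q? x∈ Qx)))
    where
      filterP≡filterQ : filter P? xs ≡ filter Q? xs
      filterP≡filterQ = Pointwise-≡⇒≡ (to-≋ (ℕ.≤-antisym (length-filter-mono P⊆Q xs) ≤P) (filter-⊆ P⊆Q xs))

  length-filter-∪-∩ : ∀ xs → length (filter (P? ∪? Q?) xs) ℕ.+ length (filter (P? ∩? Q?) xs)
                             ≡ length (filter P? xs) ℕ.+ length (filter Q? xs)
  length-filter-∪-∩ [] = refl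
  length-filter-∪-∩ (x ∷ xs) with P? x | Q? x | length-filter-∪-∩ xs
  ... | yes _ | yes _ | ih = cong suc (trans (ℕ.+-suc _ _) (trans (cong suc ih) (sym (ℕ.+-suc _ _))))
  ... | yes _ | no _  | ih = cong suc ih
  ... | no _  | yes _ | ih = trans (cong suc ih) (sym (ℕ.+-suc _ _))
  ... | no _  | no _  | ih = ih

  length-filter-disjoint-∪ : (∀ {x} → P x → Q x → ⊥) → ∀ xs →
                             length (filter (P? ∪? Q?) xs) ≡ length (filter P? xs) ℕ.+ length (filter Q? xs)
  length-filter-disjoint-∪ disjoint xs = begin
    length (filter (P? ∪? Q?) xs)
      ≡⟨ sym (ℕ.+-identityʳ _) ⟩
    length (filter (P? ∪? Q?) xs) ℕ.+ 0
      ≡⟨ cong (length (filter (P? ∪? Q?) xs) ℕ.+_) (cong length (sym none)) ⟩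
    length (filter (P? ∪? Q?) xs) ℕ.+ length (filter (P? ∩? Q?) xs)
      ≡⟨ length-filter-∪-∩ xs ⟩
    length (filter P? xs) ℕ.+ length (filter Q? xs) ∎
    where
      open ≡-Reasoning
      none : filter (P? ∩? Q?) xs ≡ []
      none = filter-none (P? ∩? Q?) {xs = xs} (All.tabulate (λ _ PQx → disjoint (proj₁ PQx) (proj₂ PQx)))

module _ {A : Set} {P : Pred A 0ℓ} (P? : Decidable P) where

  length-filter-≤1 : (∀ {x y} → P x → P y → x ≡ y) → ∀ {xs} → Unique xs → length (filter P? xs) ≤ 1
  length-filter-≤1 unique-P {[]} _ = z≤n
  length-filter-≤1 unique-P {x ∷ xs} (x∉xs ∷ u) with P? x
  ... | no _   = length-filter-≤1 unique-P u
  ... | yes Px = s≤s (ℕ.≤-reflexive (cong length (filter-none P? (none x∉xs))))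
    where
      none : ∀ {ys} → All (λ y → ¬ x ≡ y) ys → All (λ y → ¬ P y) ys
      none [] = []
      none (x≢y ∷ a) = (λ Py → x≢y (unique-P Px Py)) ∷ none a

  length-filter-none : (∀ {x} → ¬ P x) → ∀ xs → length (filter P? xs) ≡ 0
  length-filter-none ¬P xs = cong length (filter-none P? {xs = xs} (All.tabulate (λ _ → ¬P)))

  length-filter-all : (∀ x → P x) → ∀ xs → length (filter P? xs) ≡ length xs
  length-filter-all P xs = cong length (filter-all P? {xs = xs} (All.tabulate (λ {x} _ → P x)))

  length-filter-map : {B : Set} (f : B → A) → ∀ xs →
                      length (filter P? (map f xs)) ≡ length (filter (λ x → P? (f x)) xs)
  length-filter-map f [] = refl
  length-filter-map f (x ∷ xs) with P? (f x)
  ... | yes _ = cong suc (length-filter-map f xs)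
  ... | no _  = length-filter-map f xs

map-↭ : ∀ {A : Set} {f : A → A} → (∀ {x y} → f x ≡ f y → x ≡ y) → ∀ {ys} → Unique ys →
        (∀ {y} → y ∈ ys → f y ∈ ys) → (∀ {y} → y ∈ ys → y ∈ map f ys) → map f ys ↭ ys
map-↭ {f = f} f-injective {ys} unique-ys into onto =
  ∼bag⇒↭ (unique∧set⇒bag (Unique.map⁺ f-injective unique-ys) unique-ys (mk⇔ image⊆ onto))
  where
    image⊆ : ∀ {y} → y ∈ map f ys → y ∈ ys
    image⊆ y∈ with ∈-map⁻ f y∈
    ... | x , x∈ , refl = into x∈

factors-attain-bounds : ∀ {a b A B} .{{_ : ℕ.NonZero A}} .{{_ : ℕ.NonZero B}} →
                        a ≤ A → b ≤ B → A ℕ.* B ≡ a ℕ.* b → a ≡ A × b ≡ B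
factors-attain-bounds {a} {b} {A} {B} a≤A b≤B AB≡ab with ℕ.m≤n⇒m<n∨m≡n a≤A
... | inj₂ refl = refl , ℕ.≤-antisym b≤B (ℕ.≤-reflexive (ℕ.*-cancelˡ-≡ B b A AB≡ab))
... | inj₁ a<A  = ⊥-elim (ℕ.<-irrefl (sym AB≡ab) (ℕ.≤-<-trans (ℕ.*-monoʳ-≤ a b≤B) (ℕ.*-monoˡ-< B a<A)))

module FieldProperties (K : FiniteField) where

  open FiniteField K public
  open IsCommutativeRing isCommutativeRing public
    using (+-isCommutativeMonoid; *-isCommutativeMonoid; +-assoc; +-comm; +-identityˡ; +-identityʳ; -‿inverseˡ; -‿inverseʳ;
           *-assoc; *-comm; *-identityˡ; *-identityʳ; distribˡ; distribʳ; zeroˡ; zeroʳ)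

  commutativeRing : CommutativeRing 0ℓ 0ℓ
  commutativeRing = record { isCommutativeRing = isCommutativeRing }

  open import Algebra.Properties.Ring (CommutativeRing.ring commutativeRing) public
    using (+-cancelˡ; +-cancelʳ)
  open import Algebra.Solver.Ring.NaturalCoefficients.Default (CommutativeRing.commutativeSemiring commutativeRing) public
    using (solve; _:=_; _:+_; _:*_; con)
  open ≡-Reasoning

  *-cancelˡ : ∀ {a} → ¬ a ≡ 0# → ∀ {b c} → a * b ≡ a * c → b ≡ c
  *-cancelˡ {a} a≢0 {b} {c} e = begin
    b                ≡⟨ sym (*-identityˡ b) ⟩
    1# * b           ≡⟨ cong (_* b) (sym a*a⁻¹≡1) ⟩
    (a * a⁻¹) * b    ≡⟨ reassoc b ⟩
    a⁻¹ * (a * b)    ≡⟨ cong (a⁻¹ *_) e ⟩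
    a⁻¹ * (a * c)    ≡⟨ sym (reassoc c) ⟩
    (a * a⁻¹) * c    ≡⟨ cong (_* c) a*a⁻¹≡1 ⟩
    1# * c           ≡⟨ *-identityˡ c ⟩
    c                ∎
    where
      a⁻¹ : Carrier
      a⁻¹ = proj₁ (inverse a a≢0)
      a*a⁻¹≡1 : a * a⁻¹ ≡ 1#
      a*a⁻¹≡1 = proj₂ (inverse a a≢0)
      reassoc : ∀ x → (a * a⁻¹) * x ≡ a⁻¹ * (a * x)
      reassoc = solve 3 (λ a b x → ((a :* b) :* x) := (b :* (a :* x))) refl a a⁻¹

  *-nonzero : ∀ {a b} → ¬ a ≡ 0# → ¬ b ≡ 0# → ¬ a * b ≡ 0#
  *-nonzero {a} {b} a≢0 b≢0 ab≡0 = b≢0 (*-cancelˡ a≢0 (trans ab≡0 (sym (zeroʳ a))))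

  *-zero-divisor : ∀ a b → a * b ≡ 0# → a ≡ 0# ⊎ b ≡ 0#
  *-zero-divisor a b ab≡0 with a ≟ 0# | b ≟ 0#
  ... | yes a≡0 | _       = inj₁ a≡0
  ... | no _    | yes b≡0 = inj₂ b≡0
  ... | no a≢0  | no b≢0  = ⊥-elim (*-nonzero a≢0 b≢0 ab≡0)

  x*x⁻¹*y≡y : ∀ {x} (x≢0 : ¬ x ≡ 0#) y → x * (proj₁ (inverse x x≢0) * y) ≡ y
  x*x⁻¹*y≡y {x} x≢0 y = trans (sym (*-assoc x _ y)) (trans (cong (_* y) (proj₂ (inverse x x≢0))) (*-identityˡ y))

  ^-+ : ∀ x a b → x ^ (a ℕ.+ b) ≡ x ^ a * x ^ b
  ^-+ x zero    b = sym (*-identityˡ _)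
  ^-+ x (suc a) b = trans (cong (x *_) (^-+ x a b)) (sym (*-assoc x _ _))

  *-^ : ∀ x y e → (x * y) ^ e ≡ x ^ e * y ^ e
  *-^ x y zero    = sym (*-identityˡ 1#)
  *-^ x y (suc e) = trans (cong ((x * y) *_) (*-^ x y e))
    (solve 4 (λ x y a b → ((x :* y) :* (a :* b)) := ((x :* a) :* (y :* b))) refl x y (x ^ e) (y ^ e))

  1^ : ∀ e → 1# ^ e ≡ 1#
  1^ zero    = refl
  1^ (suc e) = trans (*-identityˡ _) (1^ e)

  ^-* : ∀ x a b → x ^ (a ℕ.* b) ≡ (x ^ a) ^ b
  ^-* x zero    b = sym (1^ b)
  ^-* x (suc a) b = begin
    x ^ (b ℕ.+ a ℕ.* b)     ≡⟨ ^-+ x b (a ℕ.* b) ⟩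
    x ^ b * x ^ (a ℕ.* b)   ≡⟨ cong (x ^ b *_) (^-* x a b) ⟩
    x ^ b * (x ^ a) ^ b     ≡⟨ sym (*-^ x (x ^ a) b) ⟩
    (x * x ^ a) ^ b         ∎

  ^-1 : ∀ x → x ^ 1 ≡ x
  ^-1 = *-identityʳ

  ^-nonzero : ∀ {x} e → ¬ x ≡ 0# → ¬ x ^ e ≡ 0#
  ^-nonzero zero    _   1≡0 = 0≢1 (sym 1≡0)
  ^-nonzero (suc e) x≢0 = *-nonzero x≢0 (^-nonzero e x≢0)

  Fixed : ℕ → Pred Carrier 0ℓ
  Fixed e x = x ^ e ≡ x

  fixed? : ∀ e → Decidable (Fixed e)
  fixed? e x = (x ^ e) ≟ x

  fixed-* : ∀ e {a b} → Fixed e a → Fixed e b → Fixed e (a * b)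
  fixed-* e {a} {b} a^e≡a b^e≡b = trans (*-^ a b e) (cong₂ _*_ a^e≡a b^e≡b)

  fixed-inverse : ∀ e {a b} → Fixed e a → ¬ a ≡ 0# → a * b ≡ 1# → Fixed e b
  fixed-inverse e {a} {b} a^e≡a a≢0 ab≡1 = *-cancelˡ a≢0 (begin
    a * b ^ e          ≡⟨ cong (_* b ^ e) (sym a^e≡a) ⟩
    a ^ e * b ^ e      ≡⟨ sym (*-^ a b e) ⟩
    (a * b) ^ e        ≡⟨ cong (_^ e) ab≡1 ⟩
    1# ^ e             ≡⟨ 1^ e ⟩
    1#                 ≡⟨ sym ab≡1 ⟩
    a * b              ∎)

  sumTo-cong : ∀ n {f g : ℕ → Carrier} → (∀ i → i < n → f i ≡ g i) → sumTo n f ≡ sumTo n g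
  sumTo-cong zero    f≡g = refl
  sumTo-cong (suc n) f≡g = cong₂ _+_ (sumTo-cong n (λ i i<n → f≡g i (ℕ.m<n⇒m<1+n i<n))) (f≡g n ℕ.≤-refl)

  sumTo-+ : ∀ n (f g : ℕ → Carrier) → sumTo n (λ i → f i + g i) ≡ sumTo n f + sumTo n g
  sumTo-+ zero    f g = sym (+-identityˡ 0#)
  sumTo-+ (suc n) f g = trans (cong (_+ (f n + g n)) (sumTo-+ n f g))
    (solve 4 (λ a b c d → ((a :+ b) :+ (c :+ d)) := ((a :+ c) :+ (b :+ d))) refl _ _ _ _)

  sumTo-split : ∀ a b (f : ℕ → Carrier) → sumTo (a ℕ.+ b) f ≡ sumTo a f + sumTo b (λ i → f (a ℕ.+ i))
  sumTo-split a zero    f = trans (cong (λ n → sumTo n f) (ℕ.+-identityʳ a)) (sym (+-identityʳ _))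
  sumTo-split a (suc b) f = begin
    sumTo (a ℕ.+ suc b) f                                   ≡⟨ cong (λ n → sumTo n f) (ℕ.+-suc a b) ⟩
    sumTo (a ℕ.+ b) f + f (a ℕ.+ b)                         ≡⟨ cong (_+ f (a ℕ.+ b)) (sumTo-split a b f) ⟩
    (sumTo a f + sumTo b (λ i → f (a ℕ.+ i))) + f (a ℕ.+ b)  ≡⟨ +-assoc _ _ _ ⟩
    sumTo a f + sumTo (suc b) (λ i → f (a ℕ.+ i))           ∎

  sumTo-rotate : ∀ n (f : ℕ → Carrier) → f n ≡ f 0 → sumTo n (λ i → f (suc i)) ≡ sumTo n f
  sumTo-rotate n f fn≡f0 = +-cancelˡ (f 0) _ _ (begin
    f 0 + sumTo n (λ i → f (suc i))           ≡⟨ cong (_+ sumTo n (λ i → f (suc i))) (sym (+-identityˡ (f 0))) ⟩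
    (0# + f 0) + sumTo n (λ i → f (suc i))    ≡⟨ sym (sumTo-split 1 n f) ⟩
    sumTo n f + f n                           ≡⟨ cong (sumTo n f +_) fn≡f0 ⟩
    sumTo n f + f 0                           ≡⟨ +-comm _ _ ⟩
    f 0 + sumTo n f                           ∎)

  *-sumTo : ∀ n c (f : ℕ → Carrier) → c * sumTo n f ≡ sumTo n (λ i → c * f i)
  *-sumTo zero    c f = zeroʳ c
  *-sumTo (suc n) c f = trans (distribˡ c _ _) (cong (_+ c * f n) (*-sumTo n c f))

  sumTo-* : ∀ n c (f : ℕ → Carrier) → sumTo n f * c ≡ sumTo n (λ i → f i * c)
  sumTo-* n c f = trans (*-comm _ c) (trans (*-sumTo n c f) (sumTo-cong n (λ i _ → *-comm c (f i))))

  Additive : (Carrier → Carrier) → Set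
  Additive f = ∀ x y → f (x + y) ≡ f x + f y

  additive-0 : ∀ {f} → Additive f → f 0# ≡ 0#
  additive-0 {f} f-additive = +-cancelˡ (f 0#) _ _ (begin
    f 0# + f 0#      ≡⟨ sym (f-additive 0# 0#) ⟩
    f (0# + 0#)      ≡⟨ cong f (+-identityˡ 0#) ⟩
    f 0#             ≡⟨ sym (+-identityʳ (f 0#)) ⟩
    f 0# + 0#        ∎)

  additive-sumTo : ∀ {f} → Additive f → ∀ n g → f (sumTo n g) ≡ sumTo n (λ i → f (g i))
  additive-sumTo f-additive zero    g = additive-0 f-additive
  additive-sumTo f-additive (suc n) g = trans (f-additive _ _) (cong (_+ _) (additive-sumTo f-additive n g))

  fixed-+ : ∀ e {a b} → Additive (_^ e) → Fixed e a → Fixed e b → Fixed e (a + b)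
  fixed-+ e ^e-additive a^e≡a b^e≡b = trans (^e-additive _ _) (cong₂ _+_ a^e≡a b^e≡b)

  ^-*-additive : ∀ a b → Additive (_^ a) → Additive (_^ b) → Additive (_^ (a ℕ.* b))
  ^-*-additive a b a-additive b-additive x y = begin
    (x + y) ^ (a ℕ.* b)              ≡⟨ ^-* (x + y) a b ⟩
    ((x + y) ^ a) ^ b                ≡⟨ cong (_^ b) (a-additive x y) ⟩
    (x ^ a + y ^ a) ^ b              ≡⟨ b-additive _ _ ⟩
    (x ^ a) ^ b + (y ^ a) ^ b        ≡⟨ sym (cong₂ _+_ (^-* x a b) (^-* y a b)) ⟩
    x ^ (a ℕ.* b) + y ^ (a ℕ.* b)    ∎

  ^-^-additive : ∀ a j → Additive (_^ a) → Additive (_^ (a ℕ.^ j))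
  ^-^-additive a zero    _          x y = trans (^-1 _) (sym (cong₂ _+_ (^-1 x) (^-1 y)))
  ^-^-additive a (suc j) a-additive = ^-*-additive a (a ℕ.^ j) a-additive (^-^-additive a j a-additive)

  ∃? : {P : Pred Carrier 0ℓ} → Decidable P → Dec (∃ P)
  ∃? P? = map′ satisfied (λ { (x , Px) → lose (complete x) Px }) (any? P? elements)

  module Bijection {τ σ : Carrier → Carrier} (σ∘τ : ∀ x → σ (τ x) ≡ x) (τ∘σ : ∀ x → τ (σ x) ≡ x) where

    map-elements-↭ : map τ elements ↭ elements
    map-elements-↭ = map-↭ τ-injective unique (λ _ → complete _)
                       (λ {y} _ → subst (_∈ map τ elements) (τ∘σ y) (∈-map⁺ τ (complete (σ y))))
      where
        τ-injective : ∀ {x y} → τ x ≡ τ y → x ≡ y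
        τ-injective {x} {y} e = trans (sym (σ∘τ x)) (trans (cong σ e) (σ∘τ y))

    count-∘ : {P : Pred Carrier 0ℓ} (P? : Decidable P) → count (λ x → P? (τ x)) ≡ count P?
    count-∘ P? = trans (sym (length-filter-map P? τ elements)) (↭-length (filter-↭ P? map-elements-↭))

  private
    sum : List Carrier → Carrier
    sum = foldr _+_ 0#

    product : List Carrier → Carrier
    product = foldr _*_ 1#

    sum-↭ : ∀ {xs ys} → xs ↭ ys → sum xs ≡ sum ys
    sum-↭ p = foldr-commMonoid (setoid Carrier) +-isCommutativeMonoid (↭⇒↭ₛ p)

    product-↭ : ∀ {xs ys} → xs ↭ ys → product xs ≡ product ys
    product-↭ p = foldr-commMonoid (setoid Carrier) *-isCommutativeMonoid (↭⇒↭ₛ p)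

  fromℕ : ℕ → Carrier
  fromℕ zero    = 0#
  fromℕ (suc n) = 1# + fromℕ n

  fromℕ-+ : ∀ a b → fromℕ (a ℕ.+ b) ≡ fromℕ a + fromℕ b
  fromℕ-+ zero    b = sym (+-identityˡ _)
  fromℕ-+ (suc a) b = trans (cong (1# +_) (fromℕ-+ a b)) (sym (+-assoc _ _ _))

  fromℕ-* : ∀ a b → fromℕ (a ℕ.* b) ≡ fromℕ a * fromℕ b
  fromℕ-* zero    b = sym (zeroˡ _)
  fromℕ-* (suc a) b = begin
    fromℕ (b ℕ.+ a ℕ.* b)             ≡⟨ fromℕ-+ b (a ℕ.* b) ⟩
    fromℕ b + fromℕ (a ℕ.* b)         ≡⟨ cong (fromℕ b +_) (fromℕ-* a b) ⟩
    fromℕ b + fromℕ a * fromℕ b       ≡⟨ solve 2 (λ x y → (x :+ (y :* x)) := ((con 1 :+ y) :* x)) refl (fromℕ b) (fromℕ a) ⟩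
    (1# + fromℕ a) * fromℕ b          ∎

  fromℕ-^ : ∀ a b → fromℕ (a ℕ.^ b) ≡ fromℕ a ^ b
  fromℕ-^ a zero    = +-identityʳ 1#
  fromℕ-^ a (suc b) = trans (fromℕ-* a (a ℕ.^ b)) (cong (fromℕ a *_) (fromℕ-^ a b))

  -- x ↦ x + 1 permutes the field, so adding 1 to every element does not change their sum.
  fromℕ-order : fromℕ order ≡ 0#
  fromℕ-order = +-cancelˡ (sum elements) _ _ (begin
    sum elements + fromℕ (length elements)    ≡⟨ sym (sum-map-+1 elements) ⟩
    sum (map (_+ 1#) elements)                ≡⟨ sum-↭ map-elements-↭ ⟩
    sum elements                              ≡⟨ sym (+-identityʳ _) ⟩
    sum elements + 0#                         ∎)
    where
      open Bijection {_+ 1#} {_+ - 1#}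
        (λ x → trans (+-assoc x 1# (- 1#)) (trans (cong (x +_) (-‿inverseʳ 1#)) (+-identityʳ x)))
        (λ x → trans (+-assoc x (- 1#) 1#) (trans (cong (x +_) (-‿inverseˡ 1#)) (+-identityʳ x)))
      sum-map-+1 : ∀ xs → sum (map (_+ 1#) xs) ≡ sum xs + fromℕ (length xs)
      sum-map-+1 []       = sym (+-identityˡ 0#)
      sum-map-+1 (x ∷ xs) = trans (cong ((x + 1#) +_) (sum-map-+1 xs))
        (solve 3 (λ x s n → ((x :+ con 1) :+ (s :+ n)) := ((x :+ s) :+ (con 1 :+ n))) refl x (sum xs) (fromℕ (length xs)))

  characteristic-two : ∀ n → order ≡ 2 ℕ.^ n → 1# + 1# ≡ 0#
  characteristic-two n order≡2^n with (1# + 1#) ≟ 0#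
  ... | yes 2≡0 = 2≡0
  ... | no 2≢0  = ⊥-elim (^-nonzero n (2≢0 ∘ trans (cong (1# +_) (sym (+-identityʳ 1#)))) (begin
    fromℕ 2 ^ n       ≡⟨ sym (fromℕ-^ 2 n) ⟩
    fromℕ (2 ℕ.^ n)   ≡⟨ cong fromℕ (sym order≡2^n) ⟩
    fromℕ order       ≡⟨ fromℕ-order ⟩
    0#                ∎))

  nonzero? : Decidable (λ y → ¬ y ≡ 0#)
  nonzero? y = ¬? (y ≟ 0#)

  nonzeros : List Carrier
  nonzeros = filter nonzero? elements

  ∈-nonzeros⁻ : ∀ {y} → y ∈ nonzeros → ¬ y ≡ 0#
  ∈-nonzeros⁻ y∈ = proj₂ (∈-filter⁻ nonzero? {xs = elements} y∈)

  order≡1+length-nonzeros : order ≡ suc (length nonzeros)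
  order≡1+length-nonzeros = begin
    length elements                                 ≡⟨ sym (length-filter-all zero∪nonzero? excluded-middle elements) ⟩
    length (filter zero∪nonzero? elements)          ≡⟨ length-filter-disjoint-∪ (_≟ 0#) nonzero? (λ y≡0 y≢0 → y≢0 y≡0) elements ⟩
    count (_≟ 0#) ℕ.+ length nonzeros               ≡⟨ cong (ℕ._+ length nonzeros) count-zero ⟩
    suc (length nonzeros)                           ∎
    where
      zero∪nonzero? : Decidable (λ y → y ≡ 0# ⊎ ¬ y ≡ 0#)
      zero∪nonzero? = _≟ 0# ∪? nonzero?
      excluded-middle : ∀ y → y ≡ 0# ⊎ ¬ y ≡ 0#
      excluded-middle y with y ≟ 0#
      ... | yes y≡0 = inj₁ y≡0
      ... | no y≢0  = inj₂ y≢0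
      count-zero : count (_≟ 0#) ≡ 1
      count-zero = ℕ.≤-antisym (length-filter-≤1 (_≟ 0#) (λ x≡0 y≡0 → trans x≡0 (sym y≡0)) unique)
                               (filter-some (_≟ 0#) (lose (complete 0#) refl))

  private
    product-map-* : ∀ a ys → product (map (a *_) ys) ≡ a ^ length ys * product ys
    product-map-* a []       = sym (*-identityˡ 1#)
    product-map-* a (y ∷ ys) = trans (cong ((a * y) *_) (product-map-* a ys))
      (solve 4 (λ a y b p → ((a :* y) :* (b :* p)) := ((a :* b) :* (y :* p))) refl a y _ _)

    product-nonzero : ∀ ys → (∀ {y} → y ∈ ys → ¬ y ≡ 0#) → ¬ product ys ≡ 0#
    product-nonzero []       _   1≡0 = 0≢1 (sym 1≡0)
    product-nonzero (y ∷ ys) ys≢0 = *-nonzero (ys≢0 (here refl)) (product-nonzero ys (ys≢0 ∘ there))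

  -- Multiplication by a permutes the nonzero elements, so it does not change their product.
  ^-length-nonzeros : ∀ {a} → ¬ a ≡ 0# → a ^ length nonzeros ≡ 1#
  ^-length-nonzeros {a} a≢0 = *-cancelˡ (product-nonzero nonzeros ∈-nonzeros⁻) (begin
    product nonzeros * a ^ length nonzeros    ≡⟨ *-comm _ _ ⟩
    a ^ length nonzeros * product nonzeros    ≡⟨ sym (product-map-* a nonzeros) ⟩
    product (map (a *_) nonzeros)             ≡⟨ product-↭ (map-↭ (*-cancelˡ a≢0) (Unique.filter⁺ nonzero? unique) into onto) ⟩
    product nonzeros                          ≡⟨ sym (*-identityʳ _) ⟩
    product nonzeros * 1#                     ∎)
    where
      a⁻¹ : Carrier
      a⁻¹ = proj₁ (inverse a a≢0)
      into : ∀ {y} → y ∈ nonzeros → a * y ∈ nonzeros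
      into y∈ = ∈-filter⁺ nonzero? (complete _) (*-nonzero a≢0 (∈-nonzeros⁻ y∈))
      onto : ∀ {y} → y ∈ nonzeros → y ∈ map (a *_) nonzeros
      onto {y} y∈ = subst (_∈ map (a *_) nonzeros) (x*x⁻¹*y≡y a≢0 y)
                      (∈-map⁺ (a *_) (∈-filter⁺ nonzero? (complete (a⁻¹ * y)) a⁻¹y≢0))
        where
          a⁻¹y≢0 : ¬ a⁻¹ * y ≡ 0#
          a⁻¹y≢0 a⁻¹y≡0 = ∈-nonzeros⁻ y∈ (trans (sym (x*x⁻¹*y≡y a≢0 y)) (trans (cong (a *_) a⁻¹y≡0) (zeroʳ a)))

  ^-order : ∀ x → x ^ order ≡ x
  ^-order x = trans (cong (x ^_) order≡1+length-nonzeros) (x*x^length-nonzeros≡x x)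
    where
      x*x^length-nonzeros≡x : ∀ x → x * x ^ length nonzeros ≡ x
      x*x^length-nonzeros≡x x with x ≟ 0#
      ... | yes refl = zeroˡ _
      ... | no x≢0   = trans (cong (x *_) (^-length-nonzeros x≢0)) (*-identityʳ x)

module Polynomial (K : FiniteField) where

  open FieldProperties K

  -- Coefficient lists, constant term first.
  Poly : Set
  Poly = List Carrier

  eval : Poly → Carrier → Carrier
  eval []      x = 0#
  eval (c ∷ p) x = c + x * eval p x

  leading : Poly → Carrier
  leading []          = 0#
  leading (c ∷ [])    = c
  leading (c ∷ d ∷ p) = leading (d ∷ p)

  quotient : Carrier → Poly → Poly
  quotient r []          = []
  quotient r (c ∷ [])    = []
  quotient r (c ∷ d ∷ p) = eval (d ∷ p) r ∷ quotient r (d ∷ p)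

  eval-quotient : ∀ r p x → eval p x ≡ (x + - r) * eval (quotient r p) x + eval p r
  eval-quotient r []          x = solve 1 (λ y → con 0 := (y :* con 0 :+ con 0)) refl (x + - r)
  eval-quotient r (c ∷ [])    x =
    solve 4 (λ c x r y → (c :+ x :* con 0) := (y :* con 0 :+ (c :+ r :* con 0))) refl c x r (x + - r)
  eval-quotient r (c ∷ d ∷ p) x = begin
    c + x * eval (d ∷ p) x
      ≡⟨ cong (λ z → c + x * z) (eval-quotient r (d ∷ p) x) ⟩
    c + x * ((x + - r) * Q + A)
      ≡⟨ sym (+-identityʳ _) ⟩
    c + x * ((x + - r) * Q + A) + 0#
      ≡⟨ cong (c + x * ((x + - r) * Q + A) +_) (sym -r+r*A≡0) ⟩
    c + x * ((x + - r) * Q + A) + (- r + r) * A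
      ≡⟨ solve 6 (λ c x r -r Q A → (c :+ x :* ((x :+ -r) :* Q :+ A) :+ (-r :+ r) :* A)
          := ((x :+ -r) :* (A :+ x :* Q) :+ (c :+ r :* A))) refl c x r (- r) Q A ⟩
    (x + - r) * (A + x * Q) + (c + r * A) ∎
    where
      open ≡-Reasoning
      Q = eval (quotient r (d ∷ p)) x
      A = eval (d ∷ p) r
      -r+r*A≡0 : (- r + r) * A ≡ 0#
      -r+r*A≡0 = trans (cong (_* A) (-‿inverseˡ r)) (zeroˡ A)

  length-quotient : ∀ r c p → length (quotient r (c ∷ p)) ≡ length p
  length-quotient r c []      = refl
  length-quotient r c (d ∷ p) = cong suc (length-quotient r d p)

  leading-quotient : ∀ r c d p → leading (quotient r (c ∷ d ∷ p)) ≡ leading (d ∷ p)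
  leading-quotient r c d []      = trans (cong (d +_) (zeroʳ r)) (+-identityʳ d)
  leading-quotient r c d (e ∷ p) = leading-quotient r d e p

  root? : (p : Poly) → Decidable (λ x → eval p x ≡ 0#)
  root? p x = eval p x ≟ 0#

  count-roots-≤ : ∀ d p → length p ≡ suc d → ¬ leading p ≡ 0# → count (root? p) ≤ d
  count-roots-≤ zero (c ∷ []) _ c≢0 = ℕ.≤-reflexive (length-filter-none (root? (c ∷ [])) no-root elements)
    where
      no-root : ∀ {x} → ¬ c + x * 0# ≡ 0#
      no-root {x} e = c≢0 (trans (sym (trans (cong (c +_) (zeroʳ x)) (+-identityʳ c))) e)
  count-roots-≤ (suc d) (c ∷ e ∷ p) length≡ leading≢0 with ∃? (root? (c ∷ e ∷ p))
  ... | no no-root =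
    ℕ.≤-trans (ℕ.≤-reflexive (length-filter-none (root? (c ∷ e ∷ p)) (λ {x} px≡0 → no-root (x , px≡0)) elements)) z≤n
  ... | yes (r , pr≡0) = begin-≤
    count (root? (c ∷ e ∷ p))
      ≤⟨ length-filter-mono (root? (c ∷ e ∷ p)) (_≟ r ∪? root? q) root-of-factor elements ⟩
    count (_≟ r ∪? root? q)
      ≤⟨ ℕ.m≤m+n _ _ ⟩
    count (_≟ r ∪? root? q) ℕ.+ count (_≟ r ∩? root? q)
      ≡⟨ length-filter-∪-∩ (_≟ r) (root? q) elements ⟩
    count (_≟ r) ℕ.+ count (root? q)
      ≤⟨ ℕ.+-mono-≤ (length-filter-≤1 (_≟ r) (λ x≡r y≡r → trans x≡r (sym y≡r)) unique)
          (count-roots-≤ d q length-q leading-q) ⟩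
    1 ℕ.+ d ∎
    where
      open ℕ.≤-Reasoning renaming (begin_ to begin-≤_)
      q = quotient r (c ∷ e ∷ p)
      length-q : length q ≡ suc d
      length-q = trans (length-quotient r c (e ∷ p)) (ℕ.suc-injective length≡)
      leading-q : ¬ leading q ≡ 0#
      leading-q = leading≢0 ∘ trans (sym (leading-quotient r c e p))
      root-of-factor : ∀ {x} → eval (c ∷ e ∷ p) x ≡ 0# → x ≡ r ⊎ eval q x ≡ 0#
      factored : ∀ x → eval (c ∷ e ∷ p) x ≡ (x + - r) * eval q x
      factored x = trans (eval-quotient r (c ∷ e ∷ p) x) (trans (cong ((x + - r) * eval q x +_) pr≡0) (+-identityʳ _))
      root-of-factor {x} px≡0 = Sum.map₁ (λ x-r≡0 → sym (+-cancelʳ (- r) _ _ (trans (-‿inverseʳ r) (sym x-r≡0))))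
                                          (*-zero-divisor (x + - r) (eval q x) (trans (sym (factored x)) px≡0))

  infixl 6 _⊕_
  _⊕_ : Poly → Poly → Poly
  []      ⊕ q       = q
  (a ∷ p) ⊕ []      = a ∷ p
  (a ∷ p) ⊕ (b ∷ q) = (a + b) ∷ (p ⊕ q)

  eval-⊕ : ∀ p q x → eval (p ⊕ q) x ≡ eval p x + eval q x
  eval-⊕ []      q       x = sym (+-identityˡ _)
  eval-⊕ (a ∷ p) []      x = sym (+-identityʳ _)
  eval-⊕ (a ∷ p) (b ∷ q) x = trans (cong (λ z → (a + b) + x * z) (eval-⊕ p q x))
    (solve 5 (λ a b x u v → ((a :+ b) :+ x :* (u :+ v)) := ((a :+ x :* u) :+ (b :+ x :* v))) refl a b x (eval p x) (eval q x))

  monomial : ℕ → Carrier → Poly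
  monomial zero    c = c ∷ []
  monomial (suc e) c = 0# ∷ monomial e c

  eval-monomial : ∀ e c x → eval (monomial e c) x ≡ c * x ^ e
  eval-monomial zero    c x = solve 2 (λ c x → (c :+ x :* con 0) := (c :* con 1)) refl c x
  eval-monomial (suc e) c x = trans (+-identityˡ _) (trans (cong (x *_) (eval-monomial e c x))
    (solve 3 (λ x c y → (x :* (c :* y)) := (c :* (x :* y))) refl x c (x ^ e)))

  length-⊕-monomial : ∀ p e c → length p ≤ e → length (p ⊕ monomial e c) ≡ suc e
  length-⊕-monomial []      e       c _         = length-monomial e
    where
      length-monomial : ∀ e → length (monomial e c) ≡ suc e
      length-monomial zero    = refl
      length-monomial (suc e) = cong suc (length-monomial e)
  length-⊕-monomial (a ∷ p) (suc e) c (s≤s p≤e) = cong suc (length-⊕-monomial p e c p≤e)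

  leading-⊕-monomial : ∀ p e c → length p ≤ e → leading (p ⊕ monomial e c) ≡ c
  leading-⊕-monomial []      zero          c _ = refl
  leading-⊕-monomial []      (suc zero)    c _ = refl
  leading-⊕-monomial []      (suc (suc e)) c _ = leading-⊕-monomial [] (suc e) c z≤n
  leading-⊕-monomial (a ∷ p) (suc e)       c (s≤s p≤e) =
    trans (leading-∷ {q = p ⊕ monomial e c} (length-⊕-monomial p e c p≤e)) (leading-⊕-monomial p e c p≤e)
    where
      leading-∷ : ∀ {b n q} → length q ≡ suc n → leading (b ∷ q) ≡ leading q
      leading-∷ {q = d ∷ q} _ = refl

  count-roots-⊕-monomial-≤ : ∀ p e c → length p ≤ e → ¬ c ≡ 0# → count (root? (p ⊕ monomial e c)) ≤ e
  count-roots-⊕-monomial-≤ p e c p≤e c≢0 =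
    count-roots-≤ e (p ⊕ monomial e c) (length-⊕-monomial p e c p≤e) (c≢0 ∘ trans (sym (leading-⊕-monomial p e c p≤e)))

  count-fixed-points-≤ : ∀ e → 2 ≤ e → count (λ x → (x ^ e) ≟ x) ≤ e
  count-fixed-points-≤ e 2≤e =
    ℕ.≤-trans (ℕ.≤-reflexive (length-filter-cong (λ x → (x ^ e) ≟ x) (root? p) (fixed⇒root , root⇒fixed) elements))
              (count-roots-⊕-monomial-≤ (monomial 1 (- 1#)) e 1# 2≤e (0≢1 ∘ sym))
    where
      p = monomial 1 (- 1#) ⊕ monomial e 1#
      eval-p : ∀ x → eval p x + x ≡ x ^ e
      eval-p x = begin
        eval p x + x
          ≡⟨ cong (_+ x) (trans (eval-⊕ (monomial 1 (- 1#)) (monomial e 1#) x) (cong₂ _+_ (eval-monomial 1 (- 1#) x) (eval-monomial e 1# x))) ⟩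
        (- 1# * x ^ 1 + 1# * x ^ e) + x
          ≡⟨ cong (λ z → (- 1# * z + 1# * x ^ e) + x) (^-1 x) ⟩
        (- 1# * x + 1# * x ^ e) + x
          ≡⟨ solve 3 (λ m x y → ((m :* x :+ con 1 :* y) :+ x) := ((m :+ con 1) :* x :+ y)) refl (- 1#) x (x ^ e) ⟩
        (- 1# + 1#) * x + x ^ e
          ≡⟨ cong (λ z → z * x + x ^ e) (-‿inverseˡ 1#) ⟩
        0# * x + x ^ e
          ≡⟨ trans (cong (_+ x ^ e) (zeroˡ x)) (+-identityˡ _) ⟩
        x ^ e ∎
        where open ≡-Reasoning
      fixed⇒root : ∀ {x} → x ^ e ≡ x → eval p x ≡ 0#
      fixed⇒root {x} x^e≡x = +-cancelʳ x _ _ (trans (eval-p x) (trans x^e≡x (sym (+-identityˡ x))))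
      root⇒fixed : ∀ {x} → eval p x ≡ 0# → x ^ e ≡ x
      root⇒fixed {x} px≡0 = trans (sym (eval-p x)) (trans (cong (_+ x) px≡0) (+-identityˡ x))

  module _ (q : ℕ) (2≤q : 2 ≤ q) where

    conjugate-sum : ℕ → Poly
    conjugate-sum zero    = []
    conjugate-sum (suc n) = conjugate-sum n ⊕ monomial (q ℕ.^ n) 1#

    eval-conjugate-sum : ∀ n x → eval (conjugate-sum n) x ≡ sumTo n (λ i → x ^ (q ℕ.^ i))
    eval-conjugate-sum zero    x = refl
    eval-conjugate-sum (suc n) x = trans (eval-⊕ (conjugate-sum n) _ x)
      (cong₂ _+_ (eval-conjugate-sum n x) (trans (eval-monomial (q ℕ.^ n) 1# x) (*-identityˡ _)))

    length-conjugate-sum : ∀ n → length (conjugate-sum n) ≤ q ℕ.^ n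
    length-conjugate-sum zero    = z≤n
    length-conjugate-sum (suc n) = begin
      length (conjugate-sum (suc n))   ≡⟨ length-⊕-monomial (conjugate-sum n) (q ℕ.^ n) 1# (length-conjugate-sum n) ⟩
      suc (q ℕ.^ n)                    ≤⟨ ℕ.+-monoˡ-≤ (q ℕ.^ n) 1≤q^n ⟩
      q ℕ.^ n ℕ.+ q ℕ.^ n              ≡⟨ cong (q ℕ.^ n ℕ.+_) (sym (ℕ.+-identityʳ (q ℕ.^ n))) ⟩
      2 ℕ.* q ℕ.^ n                    ≤⟨ ℕ.*-monoˡ-≤ (q ℕ.^ n) 2≤q ⟩
      q ℕ.^ suc n                      ∎
      where
        open ℕ.≤-Reasoning
        1≤q^n : 1 ≤ q ℕ.^ n
        1≤q^n = ℕ.m^n>0 q ⦃ ℕ.>-nonZero (ℕ.≤-trans (s≤s z≤n) 2≤q) ⦄ n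

    count-zeros-of-conjugate-sum-≤ : ∀ n → count (λ x → sumTo (suc n) (λ i → x ^ (q ℕ.^ i)) ≟ 0#) ≤ q ℕ.^ n
    count-zeros-of-conjugate-sum-≤ n =
      ℕ.≤-trans (ℕ.≤-reflexive (length-filter-cong _ (root? (conjugate-sum (suc n))) (zero⇒root , root⇒zero) elements))
                (count-roots-⊕-monomial-≤ (conjugate-sum n) (q ℕ.^ n) 1# (length-conjugate-sum n) (0≢1 ∘ sym))
      where
        zero⇒root : ∀ {x} → sumTo (suc n) (λ i → x ^ (q ℕ.^ i)) ≡ 0# → eval (conjugate-sum (suc n)) x ≡ 0#
        zero⇒root = trans (eval-conjugate-sum (suc n) _)
        root⇒zero : ∀ {x} → eval (conjugate-sum (suc n)) x ≡ 0# → sumTo (suc n) (λ i → x ^ (q ℕ.^ i)) ≡ 0#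
        root⇒zero = trans (sym (eval-conjugate-sum (suc n) _))

module SecondSymmetricSum (K : FiniteField) where

  open FieldProperties K
  open ≡-Reasoning

  e₂ : ℕ → (ℕ → Carrier) → Carrier
  e₂ n A = sumTo n (λ j → sumTo j (λ i → A i * A j))

  e₂-cong : ∀ n {A B : ℕ → Carrier} → (∀ i → A i ≡ B i) → e₂ n A ≡ e₂ n B
  e₂-cong n A≡B = sumTo-cong n (λ j _ → sumTo-cong j (λ i _ → cong₂ _*_ (A≡B i) (A≡B j)))

  e₂-split : ∀ a b (A : ℕ → Carrier) →
             e₂ (a ℕ.+ b) A ≡ (e₂ a A + e₂ b (λ i → A (a ℕ.+ i))) + sumTo a A * sumTo b (λ i → A (a ℕ.+ i))
  e₂-split a zero    A = trans (cong (λ n → e₂ n A) (ℕ.+-identityʳ a))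
                               (solve 2 (λ e s → e := ((e :+ con 0) :+ s :* con 0)) refl (e₂ a A) (sumTo a A))
  e₂-split a (suc b) A = begin
    e₂ (a ℕ.+ suc b) A
      ≡⟨ cong (λ n → e₂ n A) (ℕ.+-suc a b) ⟩
    e₂ (a ℕ.+ b) A + sumTo (a ℕ.+ b) (λ i → A i * A (a ℕ.+ b))
      ≡⟨ cong₂ _+_ (e₂-split a b A) (sumTo-split a b _) ⟩
    ((e₂ a A + e₂ b A′) + Σa * Σb) + (sumTo a (λ i → A i * A′ b) + sumTo b (λ i → A′ i * A′ b))
      ≡⟨ cong (λ z → ((e₂ a A + e₂ b A′) + Σa * Σb) + (z + sumTo b (λ i → A′ i * A′ b))) (sym (sumTo-* a (A′ b) A)) ⟩
    ((e₂ a A + e₂ b A′) + Σa * Σb) + (Σa * A′ b + sumTo b (λ i → A′ i * A′ b))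
      ≡⟨ solve 6 (λ e e′ s t y z → (((e :+ e′) :+ s :* t) :+ (s :* y :+ z))
          := ((e :+ (e′ :+ z)) :+ s :* (t :+ y))) refl _ _ _ _ _ _ ⟩
    (e₂ a A + e₂ (suc b) A′) + Σa * sumTo (suc b) A′ ∎
    where
      A′ = λ i → A (a ℕ.+ i)
      Σa = sumTo a A
      Σb = sumTo b A′

  module _ (A B : ℕ → Carrier) where

    mixed : ℕ → Carrier
    mixed n = sumTo n (λ j → sumTo j (λ i → A i * B j + B i * A j))

    e₂-+-mixed : ∀ n → e₂ n (λ i → A i + B i) ≡ (e₂ n A + e₂ n B) + mixed n
    e₂-+-mixed zero    = solve 0 (con 0 := ((con 0 :+ con 0) :+ con 0)) refl
    e₂-+-mixed (suc n) = begin
      e₂ n (λ i → A i + B i) + sumTo n (λ i → (A i + B i) * (A n + B n))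
        ≡⟨ cong₂ _+_ (e₂-+-mixed n) (trans (sumTo-cong n (λ i _ → expand (A i) (B i) (A n) (B n)))
            (trans (sumTo-+ n _ _) (cong (_+ sumTo n (λ i → A i * B n + B i * A n)) (sumTo-+ n _ _)))) ⟩
      ((e₂ n A + e₂ n B) + mixed n) + ((sumTo n (λ i → A i * A n) + sumTo n (λ i → B i * B n)) + sumTo n (λ i → A i * B n + B i * A n))
        ≡⟨ solve 6 (λ a b x c d e → (((a :+ b) :+ x) :+ ((c :+ d) :+ e)) := (((a :+ c) :+ (b :+ d)) :+ (x :+ e))) refl _ _ _ _ _ _ ⟩
      (e₂ (suc n) A + e₂ (suc n) B) + mixed (suc n) ∎
      where
        expand : ∀ a b c d → (a + b) * (c + d) ≡ (a * c + b * d) + (a * d + b * c)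
        expand = solve 4 (λ a b c d → ((a :+ b) :* (c :+ d)) := ((a :* c :+ b :* d) :+ (a :* d :+ b :* c))) refl

    mixed-+-diagonal : ∀ n → mixed n + sumTo n (λ i → A i * B i) ≡ sumTo n A * sumTo n B
    mixed-+-diagonal zero    = solve 0 ((con 0 :+ con 0) := (con 0 :* con 0)) refl
    mixed-+-diagonal (suc n) = begin
      (mixed n + sumTo n (λ i → A i * B n + B i * A n)) + (Δ + A n * B n)
        ≡⟨ cong (λ z → (mixed n + z) + (Δ + A n * B n)) (trans (sumTo-+ n _ _) (sym (cong₂ _+_ (sumTo-* n (B n) A) (sumTo-* n (A n) B)))) ⟩
      (mixed n + (ΣA * B n + ΣB * A n)) + (Δ + A n * B n)
        ≡⟨ solve 6 (λ x d sa sb an bn → ((x :+ (sa :* bn :+ sb :* an)) :+ (d :+ an :* bn)) := ((x :+ d) :+ (sa :* bn :+ sb :* an :+ an :* bn))) refl (mixed n) Δ ΣA ΣB (A n) (B n) ⟩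
      (mixed n + Δ) + (ΣA * B n + ΣB * A n + A n * B n)
        ≡⟨ cong (_+ (ΣA * B n + ΣB * A n + A n * B n)) (mixed-+-diagonal n) ⟩
      ΣA * ΣB + (ΣA * B n + ΣB * A n + A n * B n)
        ≡⟨ solve 4 (λ sa sb an bn → ((sa :* sb) :+ (sa :* bn :+ sb :* an :+ an :* bn)) := ((sa :+ an) :* (sb :+ bn))) refl ΣA ΣB (A n) (B n) ⟩
      (ΣA + A n) * (ΣB + B n) ∎
      where
        ΣA = sumTo n A
        ΣB = sumTo n B
        Δ = sumTo n (λ i → A i * B i)

  e₂-^ : ∀ e → Additive (_^ e) → ∀ n (A : ℕ → Carrier) → e₂ n A ^ e ≡ e₂ n (λ i → A i ^ e)
  e₂-^ e ^e-additive n A = trans (additive-sumTo ^e-additive n _)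
    (sumTo-cong n (λ j _ → trans (additive-sumTo ^e-additive j _) (sumTo-cong j (λ i _ → *-^ (A i) (A j) e))))

  e₂-rotate : ∀ n (A : ℕ → Carrier) → A (suc n) ≡ A 0 → e₂ (suc n) (λ i → A (suc i)) ≡ e₂ (suc n) A
  e₂-rotate n A A[n+1]≡A0 = sym (begin
    e₂ (1 ℕ.+ n) A
      ≡⟨ e₂-split 1 n A ⟩
    ((0# + 0#) + e₂ n A′) + (0# + A 0) * sumTo n A′
      ≡⟨ solve 3 (λ e a s → (((con 0 :+ con 0) :+ e) :+ (con 0 :+ a) :* s) := (e :+ s :* a)) refl (e₂ n A′) (A 0) (sumTo n A′) ⟩
    e₂ n A′ + sumTo n A′ * A 0
      ≡⟨ cong (e₂ n A′ +_) (trans (cong (sumTo n A′ *_) (sym A[n+1]≡A0)) (sumTo-* n (A (suc n)) A′)) ⟩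
    e₂ (suc n) A′ ∎)
    where
      A′ = λ i → A (suc i)

module CharacteristicTwo (K : FiniteField)
                         (1+1≡0 : FiniteField._+_ K (FiniteField.1# K) (FiniteField.1# K) ≡ FiniteField.0# K) where

  open FieldProperties K
  open ≡-Reasoning

  x+x≡0 : ∀ x → x + x ≡ 0#
  x+x≡0 x = begin
    x + x           ≡⟨ solve 1 (λ x → (x :+ x) := (x :* (con 1 :+ con 1))) refl x ⟩
    x * (1# + 1#)   ≡⟨ cong (x *_) 1+1≡0 ⟩
    x * 0#          ≡⟨ zeroʳ x ⟩
    0#              ∎

  x+y+y≡x : ∀ x y → (x + y) + y ≡ x
  x+y+y≡x x y = trans (+-assoc x y y) (trans (cong (x +_) (x+x≡0 y)) (+-identityʳ x))

  x+y≡0⇒x≡y : ∀ {x y} → x + y ≡ 0# → x ≡ y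
  x+y≡0⇒x≡y {x} {y} x+y≡0 = trans (sym (x+y+y≡x x y)) (trans (cong (_+ y) x+y≡0) (+-identityˡ y))

  x+y≡z⇒x≡y+z : ∀ {x y z} → x + y ≡ z → x ≡ y + z
  x+y≡z⇒x≡y+z {x} {y} {z} x+y≡z = trans (sym (x+y+y≡x x y)) (trans (cong (_+ y) x+y≡z) (+-comm z y))

  square-additive : Additive (_^ 2)
  square-additive x y = begin
    (x + y) * ((x + y) * 1#)
      ≡⟨ solve 2 (λ x y → ((x :+ y) :* ((x :+ y) :* con 1)) :=
          ((x :* (x :* con 1) :+ y :* (y :* con 1)) :+ (x :* y) :* (con 1 :+ con 1))) refl x y ⟩
    (x * (x * 1#) + y * (y * 1#)) + (x * y) * (1# + 1#)
      ≡⟨ cong (λ z → (x * (x * 1#) + y * (y * 1#)) + (x * y) * z) 1+1≡0 ⟩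
    (x * (x * 1#) + y * (y * 1#)) + (x * y) * 0#
      ≡⟨ trans (cong (_ +_) (zeroʳ _)) (+-identityʳ _) ⟩
    x * (x * 1#) + y * (y * 1#) ∎

  module AdditiveMap {P : Pred Carrier 0ℓ} (P? : Decidable P) (P-+ : ∀ {x y} → P x → P y → P (x + y))
                     {f : Carrier → Carrier} (f-additive : Additive f) where

    open import Data.List.Membership.DecPropositional _≟_ using (_∈?_)

    fibre? : ∀ y → Decidable (λ x → P x × f x ≡ y)
    fibre? y x = P? x ×-dec (f x ≟ y)

    kernel? : Decidable (λ x → P x × f x ≡ 0#)
    kernel? = fibre? 0#

    Image : Pred Carrier 0ℓ
    Image y = ∃ λ x → P x × f x ≡ y

    image? : Decidable Image
    image? y = ∃? (fibre? y)

    count-fibre : ∀ {y} → Image y → count (fibre? y) ≡ count kernel?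
    count-fibre {y} (x₀ , Px₀ , fx₀≡y) =
      trans (sym (count-∘ (fibre? y))) (length-filter-cong _ kernel? (shifted⇒kernel , kernel⇒shifted) elements)
      where
        open Bijection {_+ x₀} {_+ x₀} (λ x → x+y+y≡x x x₀) (λ x → x+y+y≡x x x₀)
        f-shift : ∀ x → f (x + x₀) ≡ f x + y
        f-shift x = trans (f-additive x x₀) (cong (f x +_) fx₀≡y)
        shifted⇒kernel : ∀ {x} → P (x + x₀) × f (x + x₀) ≡ y → P x × f x ≡ 0#
        shifted⇒kernel {x} (Px+x₀ , fx+x₀≡y) =
          subst P (x+y+y≡x x x₀) (P-+ Px+x₀ Px₀) , trans (x+y≡z⇒x≡y+z (trans (sym (f-shift x)) fx+x₀≡y)) (x+x≡0 y)
        kernel⇒shifted : ∀ {x} → P x × f x ≡ 0# → P (x + x₀) × f (x + x₀) ≡ y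
        kernel⇒shifted {x} (Px , fx≡0) = P-+ Px Px₀ , trans (f-shift x) (trans (cong (_+ y) fx≡0) (+-identityˡ y))

    count-domain≡kernel*image : count P? ≡ count kernel? ℕ.* count image?
    count-domain≡kernel*image =
      trans (length-filter-cong P? (value∈? elements) ((λ Px → Px , complete _) , proj₁) elements) (count-values elements unique)
      where
        value∈? : (ys : List Carrier) → Decidable (λ x → P x × f x ∈ ys)
        value∈? ys x = P? x ×-dec (f x ∈? ys)

        count-fibre-* : ∀ y ys → count (fibre? y) ℕ.+ count kernel? ℕ.* length (filter image? ys)
                                 ≡ count kernel? ℕ.* length (filter image? (y ∷ ys))
        count-fibre-* y ys with image? y
        ... | yes y∈image = begin
          count (fibre? y) ℕ.+ count kernel? ℕ.* length (filter image? ys)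
            ≡⟨ cong (ℕ._+ _) (count-fibre y∈image) ⟩
          count kernel? ℕ.+ count kernel? ℕ.* length (filter image? ys)
            ≡⟨ sym (ℕ.*-suc (count kernel?) _) ⟩
          count kernel? ℕ.* suc (length (filter image? ys))
            ≡⟨ cong (λ zs → count kernel? ℕ.* length zs) (sym (filter-accept image? y∈image)) ⟩
          count kernel? ℕ.* length (filter image? (y ∷ ys)) ∎
        ... | no y∉image  = begin
          count (fibre? y) ℕ.+ count kernel? ℕ.* length (filter image? ys)
            ≡⟨ cong (ℕ._+ _) (length-filter-none (fibre? y) (λ {x} fibre-x → y∉image (x , fibre-x)) elements) ⟩
          count kernel? ℕ.* length (filter image? ys)
            ≡⟨ cong (λ zs → count kernel? ℕ.* length zs) (sym (filter-reject image? y∉image)) ⟩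
          count kernel? ℕ.* length (filter image? (y ∷ ys)) ∎

        count-values : ∀ ys → Unique ys → count (value∈? ys) ≡ count kernel? ℕ.* length (filter image? ys)
        count-values [] _ = trans (length-filter-none (value∈? []) (λ ()) elements)
                                  (sym (ℕ.*-zeroʳ (count kernel?)))
        count-values (y ∷ ys) (y∉ys ∷ unique-ys) = begin
          count (value∈? (y ∷ ys))
            ≡⟨ length-filter-cong _ _ (split , merge) elements ⟩
          count (fibre? y ∪? value∈? ys)
            ≡⟨ length-filter-disjoint-∪ (fibre? y) (value∈? ys) disjoint elements ⟩
          count (fibre? y) ℕ.+ count (value∈? ys)
            ≡⟨ cong (count (fibre? y) ℕ.+_) (count-values ys unique-ys) ⟩
          count (fibre? y) ℕ.+ count kernel? ℕ.* length (filter image? ys) ≡⟨ count-fibre-* y ys ⟩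
          count kernel? ℕ.* length (filter image? (y ∷ ys)) ∎
          where
            split : ∀ {x} → P x × f x ∈ y ∷ ys → (P x × f x ≡ y) ⊎ (P x × f x ∈ ys)
            split (Px , here fx≡y)   = inj₁ (Px , fx≡y)
            split (Px , there fx∈ys) = inj₂ (Px , fx∈ys)
            merge : ∀ {x} → (P x × f x ≡ y) ⊎ (P x × f x ∈ ys) → P x × f x ∈ y ∷ ys
            merge (inj₁ (Px , fx≡y))  = Px , here fx≡y
            merge (inj₂ (Px , fx∈ys)) = Px , there fx∈ys
            disjoint : ∀ {x} → P x × f x ≡ y → P x × f x ∈ ys → ⊥
            disjoint (_ , refl) (_ , fx∈ys) = All.lookup y∉ys fx∈ys refl

  open SecondSymmetricSum K

  e₂-+ : ∀ n (A B : ℕ → Carrier) →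
         e₂ n (λ i → A i + B i) ≡ ((e₂ n A + e₂ n B) + sumTo n A * sumTo n B) + sumTo n (λ i → A i * B i)
  e₂-+ n A B = begin
    e₂ n (λ i → A i + B i)
      ≡⟨ e₂-+-mixed A B n ⟩
    (e₂ n A + e₂ n B) + mixed A B n
      ≡⟨ cong ((e₂ n A + e₂ n B) +_) (x+y≡z⇒x≡y+z (mixed-+-diagonal A B n)) ⟩
    (e₂ n A + e₂ n B) + (Δ + ΣA * ΣB)
      ≡⟨ solve 4 (λ e d s t → (e :+ (d :+ s :* t)) := ((e :+ s :* t) :+ d)) refl (e₂ n A + e₂ n B) Δ ΣA ΣB ⟩
    ((e₂ n A + e₂ n B) + ΣA * ΣB) + Δ ∎
    where
      ΣA = sumTo n A
      ΣB = sumTo n B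
      Δ = sumTo n (λ i → A i * B i)

module FieldOfOrderQ² (K : FiniteField) (k m : ℕ) (k≥1 : k ℕ.≥ 1) (m≥1 : m ℕ.≥ 1)
                       (order≡ : FiniteField.order K ≡ (2 ℕ.^ k) ℕ.^ (4 ℕ.* m)) where

  open FieldProperties K
  open SecondSymmetricSum K using (e₂; e₂-cong; e₂-split; e₂-rotate; e₂-^)
  open Polynomial K using (count-fixed-points-≤; count-zeros-of-conjugate-sum-≤)

  q Q r : ℕ
  q = 2 ℕ.^ k
  Q = q ℕ.^ (2 ℕ.* m)
  r = q ℕ.^ (2 ℕ.* m ∸ 1)

  1+1≡0 : 1# + 1# ≡ 0#
  1+1≡0 = characteristic-two (k ℕ.* (4 ℕ.* m)) (trans order≡ (ℕ.^-*-assoc 2 k (4 ℕ.* m)))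

  open CharacteristicTwo K 1+1≡0

  2≤q : 2 ≤ q
  2≤q = ℕ.^-monoʳ-≤ 2 k≥1

  instance
    q-nonZero : ℕ.NonZero q
    q-nonZero = ℕ.>-nonZero (ℕ.≤-trans (s≤s z≤n) 2≤q)

  2≤Q : 2 ≤ Q
  2≤Q = ℕ.≤-trans 2≤q (ℕ.≤-trans (ℕ.≤-reflexive (sym (ℕ.^-identityʳ q))) (ℕ.^-monoʳ-≤ q (ℕ.≤-trans m≥1 (ℕ.m≤m+n m _))))

  2m≡1+[2m∸1] : 2 ℕ.* m ≡ suc (2 ℕ.* m ∸ 1)
  2m≡1+[2m∸1] = trans (sym (ℕ.m∸n+n≡m (ℕ.≤-trans m≥1 (ℕ.m≤m+n m _)))) (ℕ.+-comm _ 1)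

  4m≡2m+2m : 4 ℕ.* m ≡ 2 ℕ.* m ℕ.+ 2 ℕ.* m
  4m≡2m+2m = ℕ.*-distribʳ-+ m 2 2

  order≡Q*Q : order ≡ Q ℕ.* Q
  order≡Q*Q = trans order≡ (trans (cong (q ℕ.^_) 4m≡2m+2m) (ℕ.^-distribˡ-+-* q (2 ℕ.* m) (2 ℕ.* m)))

  Q≡r*q : Q ≡ r ℕ.* q
  Q≡r*q = trans (cong (q ℕ.^_) 2m≡1+[2m∸1]) (ℕ.*-comm q r)

  r<Q : r < Q
  r<Q = subst (r <_) (sym Q≡r*q) (ℕ.m<m*n r q 2≤q)
    where
      instance
        r-nonZero : ℕ.NonZero r
        r-nonZero = ℕ.m^n≢0 q (2 ℕ.* m ∸ 1)

  frobenius-q : Additive (_^ q)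
  frobenius-q = ^-^-additive 2 k square-additive

  frobenius : ∀ i → Additive (_^ (q ℕ.^ i))
  frobenius i = ^-^-additive q i frobenius-q

  conjugate : Carrier → ℕ → Carrier
  conjugate x i = x ^ (q ℕ.^ i)

  Tr₄ₘ St₄ₘ : Carrier → Carrier
  Tr₄ₘ = Tr q (4 ℕ.* m)
  St₄ₘ = St q (4 ℕ.* m)

  conjugate-suc : ∀ x i → conjugate x i ^ q ≡ conjugate x (suc i)
  conjugate-suc x i = trans (sym (^-* x (q ℕ.^ i) q)) (cong (x ^_) (ℕ.*-comm (q ℕ.^ i) q))

  conjugate-+ : ∀ x a b → conjugate x (a ℕ.+ b) ≡ conjugate (conjugate x a) b
  conjugate-+ x a b = trans (cong (x ^_) (ℕ.^-distribˡ-+-* q a b)) (^-* x (q ℕ.^ a) (q ℕ.^ b))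

  fixed-q⇒conjugate≡ : ∀ {c} → Fixed q c → ∀ i → conjugate c i ≡ c
  fixed-q⇒conjugate≡ c^q≡c zero    = ^-1 _
  fixed-q⇒conjugate≡ {c} c^q≡c (suc i) = trans (^-* c q (q ℕ.^ i)) (trans (cong (_^ (q ℕ.^ i)) c^q≡c) (fixed-q⇒conjugate≡ c^q≡c i))

  fixed-q⇒fixed-Q : ∀ {c} → Fixed q c → Fixed Q c
  fixed-q⇒fixed-Q c^q≡c = fixed-q⇒conjugate≡ c^q≡c (2 ℕ.* m)

  fixed-Q-+ : ∀ {a b} → Fixed Q a → Fixed Q b → Fixed Q (a + b)
  fixed-Q-+ = fixed-+ Q (frobenius (2 ℕ.* m))

  ^Q^Q : ∀ x → (x ^ Q) ^ Q ≡ x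
  ^Q^Q x = trans (sym (^-* x Q Q)) (trans (cong (x ^_) (sym order≡Q*Q)) (^-order x))

  trQ : Carrier → Carrier
  trQ x = x ^ Q + x

  trQ-additive : Additive trQ
  trQ-additive a b = trans (cong (_+ (a + b)) (frobenius (2 ℕ.* m) a b))
    (solve 4 (λ a b c d → ((c :+ d) :+ (a :+ b)) := ((c :+ a) :+ (d :+ b))) refl a b (a ^ Q) (b ^ Q))

  trQ-fixed-Q : ∀ {x} → Fixed Q x → trQ x ≡ 0#
  trQ-fixed-Q {x} x^Q≡x = trans (cong (_+ x) x^Q≡x) (x+x≡0 x)

  -- trQ is the trace onto the subfield of order Q. Its kernel is that subfield and its image lies in it;
  -- since the field has Q * Q elements and x ^ Q = x has at most Q roots, both have exactly Q elements.
  module TraceOntoSubfield where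

    open AdditiveMap {P = λ _ → ⊤} (λ _ → yes tt) (λ _ _ → tt) trQ-additive public

    image⊆fixed-Q : ∀ {y} → Image y → Fixed Q y
    image⊆fixed-Q (x , _ , refl) = trans (frobenius (2 ℕ.* m) (x ^ Q) x) (trans (cong (_+ x ^ Q) (^Q^Q x)) (+-comm x (x ^ Q)))

    count-kernel : count kernel? ≡ count (fixed? Q)
    count-kernel = length-filter-cong kernel? (fixed? Q) ((λ trQ≡0 → x+y≡0⇒x≡y (proj₂ trQ≡0)) , (λ x^Q≡x → tt , trQ-fixed-Q x^Q≡x)) elements

    count-fixed-Q-and-image : count (fixed? Q) ≡ Q × count image? ≡ Q
    count-fixed-Q-and-image = factors-attain-bounds (count-fixed-points-≤ Q 2≤Q) image≤Q (begin
      Q ℕ.* Q                                  ≡⟨ sym order≡Q*Q ⟩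
      order                                    ≡⟨ sym (length-filter-all (λ _ → yes tt) _ elements) ⟩
      count (λ _ → yes tt)                     ≡⟨ count-domain≡kernel*image ⟩
      count kernel? ℕ.* count image?           ≡⟨ cong (ℕ._* count image?) count-kernel ⟩
      count (fixed? Q) ℕ.* count image?        ∎)
      where
        open ≡-Reasoning
        image≤Q : count image? ≤ Q
        image≤Q = ℕ.≤-trans (length-filter-mono image? (fixed? Q) image⊆fixed-Q elements) (count-fixed-points-≤ Q 2≤Q)
        instance
          Q-nonZero : ℕ.NonZero Q
          Q-nonZero = ℕ.m^n≢0 q (2 ℕ.* m)

    fixed-Q⇒image : ∀ {y} → Fixed Q y → Image y
    fixed-Q⇒image = ⊇-by-length-filter image? (fixed? Q) image⊆fixed-Q elements
      (ℕ.≤-reflexive (trans (proj₁ count-fixed-Q-and-image) (sym (proj₂ count-fixed-Q-and-image)))) (complete _)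

  tr : Carrier → Carrier
  tr = Tr q (2 ℕ.* m)

  tr-additive : Additive tr
  tr-additive a b = trans (sumTo-cong (2 ℕ.* m) (λ i _ → frobenius i a b)) (sumTo-+ (2 ℕ.* m) _ _)

  tr-linear : ∀ {c} → Fixed q c → ∀ x → tr (c * x) ≡ c * tr x
  tr-linear {c} c^q≡c x = trans (sumTo-cong (2 ℕ.* m) (λ i _ → trans (*-^ c x (q ℕ.^ i)) (cong (_* conjugate x i) (fixed-q⇒conjugate≡ c^q≡c i))))
    (sym (*-sumTo (2 ℕ.* m) c _))

  tr-fixed-q : ∀ {x} → Fixed Q x → Fixed q (tr x)
  tr-fixed-q {x} x^Q≡x = begin
    tr x ^ q                                       ≡⟨ additive-sumTo frobenius-q (2 ℕ.* m) (conjugate x) ⟩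
    sumTo (2 ℕ.* m) (λ i → conjugate x i ^ q)      ≡⟨ sumTo-cong (2 ℕ.* m) (λ i _ → conjugate-suc x i) ⟩
    sumTo (2 ℕ.* m) (λ i → conjugate x (suc i))    ≡⟨ sumTo-rotate (2 ℕ.* m) (conjugate x) (trans x^Q≡x (sym (^-1 x))) ⟩
    tr x                                           ∎
    where open ≡-Reasoning

  module TraceOntoFq where

    open AdditiveMap (fixed? Q) fixed-Q-+ tr-additive public

    image⊆fixed-q : ∀ {y} → Image y → Fixed q y
    image⊆fixed-q (x , x^Q≡x , refl) = tr-fixed-q x^Q≡x

    count-kernel≤r : count kernel? ≤ r
    count-kernel≤r = ℕ.≤-trans (length-filter-mono kernel? _ kernel⊆zeros elements) (count-zeros-of-conjugate-sum-≤ q 2≤q (2 ℕ.* m ∸ 1))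
      where
        kernel⊆zeros : ∀ {x} → Fixed Q x × tr x ≡ 0# → sumTo (suc (2 ℕ.* m ∸ 1)) (conjugate x) ≡ 0#
        kernel⊆zeros {x} (_ , tr≡0) = subst (λ n → sumTo n (conjugate x) ≡ 0#) 2m≡1+[2m∸1] tr≡0

    count-kernel-and-image : count kernel? ≡ r × count image? ≡ q
    count-kernel-and-image = factors-attain-bounds ⦃ ℕ.m^n≢0 q (2 ℕ.* m ∸ 1) ⦄ count-kernel≤r
      (ℕ.≤-trans (length-filter-mono image? (fixed? q) image⊆fixed-q elements) (count-fixed-points-≤ q 2≤q))
      (trans (sym Q≡r*q) (trans (sym (proj₁ TraceOntoSubfield.count-fixed-Q-and-image)) count-domain≡kernel*image))

    fixed-q⇒image : ∀ {y} → Fixed q y → Image y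
    fixed-q⇒image = ⊇-by-length-filter image? (fixed? q) image⊆fixed-q elements
      (ℕ.≤-trans (count-fixed-points-≤ q 2≤q) (ℕ.≤-reflexive (sym (proj₂ count-kernel-and-image)))) (complete _)

    count-fixed-q : count (fixed? q) ≡ q
    count-fixed-q = trans (length-filter-cong (fixed? q) image? (fixed-q⇒image , image⊆fixed-q) elements) (proj₂ count-kernel-and-image)

  -- With tr e₀ = 1 and c = tr (α e₀), tr (α x) vanishing on the kernel of tr forces tr ((α + c) y) = 0 for all y in L;
  -- as tr does not vanish on all of L, α + c = 0.
  module _ {α : Carrier} (α^Q≡α : Fixed Q α) (vanishing : ∀ {x} → Fixed Q x → tr x ≡ 0# → tr (α * x) ≡ 0#) where

    private
      unit : TraceOntoFq.Image 1#
      unit = TraceOntoFq.fixed-q⇒image (1^ q)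
      e₀ : Carrier
      e₀ = proj₁ unit
      e₀^Q≡e₀ : Fixed Q e₀
      e₀^Q≡e₀ = proj₁ (proj₂ unit)
      tr-e₀≡1 : tr e₀ ≡ 1#
      tr-e₀≡1 = proj₂ (proj₂ unit)
      c : Carrier
      c = tr (α * e₀)
      c^q≡c : Fixed q c
      c^q≡c = tr-fixed-q (fixed-* Q α^Q≡α e₀^Q≡e₀)

      tr-α*≡tr*c : ∀ {y} → Fixed Q y → tr (α * y) ≡ tr y * c
      tr-α*≡tr*c {y} y^Q≡y = x+y≡0⇒x≡y (begin
        tr (α * y) + tr y * c
          ≡⟨ cong (tr (α * y) +_) (sym (tr-linear tr-y^q≡tr-y (α * e₀))) ⟩
        tr (α * y) + tr (tr y * (α * e₀))
          ≡⟨ sym (tr-additive _ _) ⟩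
        tr (α * y + tr y * (α * e₀))
          ≡⟨ cong tr (solve 4 (λ a y t e → (a :* y :+ t :* (a :* e)) := (a :* (y :+ t :* e))) refl α y (tr y) e₀) ⟩
        tr (α * (y + tr y * e₀))
          ≡⟨ vanishing (fixed-Q-+ y^Q≡y (fixed-* Q (fixed-q⇒fixed-Q tr-y^q≡tr-y) e₀^Q≡e₀)) tr-shifted≡0 ⟩
        0# ∎)
        where
          open ≡-Reasoning
          tr-y^q≡tr-y : Fixed q (tr y)
          tr-y^q≡tr-y = tr-fixed-q y^Q≡y
          tr-shifted≡0 : tr (y + tr y * e₀) ≡ 0#
          tr-shifted≡0 = trans (tr-additive _ _)
            (trans (cong (tr y +_) (trans (tr-linear tr-y^q≡tr-y e₀) (trans (cong (tr y *_) tr-e₀≡1) (*-identityʳ _)))) (x+x≡0 _))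

      tr-[α+c]*≡0 : ∀ {y} → Fixed Q y → tr ((α + c) * y) ≡ 0#
      tr-[α+c]*≡0 {y} y^Q≡y = begin
        tr ((α + c) * y)              ≡⟨ trans (cong tr (distribʳ y α c)) (tr-additive _ _) ⟩
        tr (α * y) + tr (c * y)       ≡⟨ cong₂ _+_ (tr-α*≡tr*c y^Q≡y) (tr-linear c^q≡c y) ⟩
        tr y * c + c * tr y           ≡⟨ cong (tr y * c +_) (*-comm c (tr y)) ⟩
        tr y * c + tr y * c           ≡⟨ x+x≡0 _ ⟩
        0#                            ∎
        where open ≡-Reasoning

      tr-vanishes : ¬ α + c ≡ 0# → ∀ {y} → Fixed Q y → tr y ≡ 0#
      tr-vanishes α+c≢0 {y} y^Q≡y =
        trans (cong tr (sym (x*x⁻¹*y≡y α+c≢0 y)))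
              (tr-[α+c]*≡0 (fixed-* Q (fixed-inverse Q (fixed-Q-+ α^Q≡α (fixed-q⇒fixed-Q c^q≡c)) α+c≢0 (proj₂ (inverse _ α+c≢0))) y^Q≡y))

      α+c≡0 : α + c ≡ 0#
      α+c≡0 = decidable-stable ((α + c) ≟ 0#) λ α+c≢0 → ℕ.<-irrefl refl (begin-strict
        count TraceOntoFq.kernel?
          ≡⟨ proj₁ TraceOntoFq.count-kernel-and-image ⟩
        r
          <⟨ r<Q ⟩
        Q
          ≡⟨ sym (proj₁ TraceOntoSubfield.count-fixed-Q-and-image) ⟩
        count (fixed? Q)
          ≤⟨ length-filter-mono (fixed? Q) TraceOntoFq.kernel? (λ y^Q≡y → y^Q≡y , tr-vanishes α+c≢0 y^Q≡y) elements ⟩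
        count TraceOntoFq.kernel? ∎)
        where open ℕ.≤-Reasoning

    tr-vanishing-on-kernel⇒fixed-q : Fixed q α
    tr-vanishing-on-kernel⇒fixed-q = subst (Fixed q) (sym (x+y≡0⇒x≡y α+c≡0)) c^q≡c

  module QuadraticForm (α : Carrier) (α^Q≡α : Fixed Q α) (α∉Fq : ¬ Fixed q α) where

    g : Carrier → Carrier
    g x = tr x * tr x + tr (α * x)

    square-tr-additive : Additive (λ x → tr x * tr x)
    square-tr-additive a b = begin
      tr (a + b) * tr (a + b)
        ≡⟨ cong₂ _*_ (tr-additive a b) (tr-additive a b) ⟩
      (tr a + tr b) * (tr a + tr b)
        ≡⟨ solve 2 (λ x y → ((x :+ y) :* (x :+ y)) := ((x :+ y) :* ((x :+ y) :* con 1))) refl (tr a) (tr b) ⟩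
      (tr a + tr b) ^ 2
        ≡⟨ square-additive (tr a) (tr b) ⟩
      tr a ^ 2 + tr b ^ 2
        ≡⟨ solve 2 (λ x y → (x :* (x :* con 1) :+ y :* (y :* con 1)) := (x :* x :+ y :* y)) refl (tr a) (tr b) ⟩
      tr a * tr a + tr b * tr b ∎
      where open ≡-Reasoning

    g-additive : Additive g
    g-additive a b = begin
      tr (a + b) * tr (a + b) + tr (α * (a + b))
        ≡⟨ cong₂ _+_ (square-tr-additive a b) (trans (cong tr (distribˡ α a b)) (tr-additive _ _)) ⟩
      (tr a * tr a + tr b * tr b) + (tr (α * a) + tr (α * b))
        ≡⟨ solve 4 (λ a b c d → ((a :+ b) :+ (c :+ d)) := ((a :+ c) :+ (b :+ d))) refl _ _ _ _ ⟩
      g a + g b ∎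
      where open ≡-Reasoning

    open AdditiveMap (fixed? Q) fixed-Q-+ g-additive public

    image⊆fixed-q : ∀ {y} → Image y → Fixed q y
    image⊆fixed-q (x , x^Q≡x , refl) =
      fixed-+ q frobenius-q (fixed-* q (tr-fixed-q x^Q≡x) (tr-fixed-q x^Q≡x)) (tr-fixed-q (fixed-* Q α^Q≡α x^Q≡x))

    KernelWitness : Set
    KernelWitness = ∃ λ x → Fixed Q x × tr x ≡ 0# × ¬ tr (α * x) ≡ 0#

    kernel-witness : KernelWitness
    kernel-witness = decidable-stable (∃? witness?) λ no-witness → α∉Fq (tr-vanishing-on-kernel⇒fixed-q α^Q≡α (vanishing no-witness))
      where
        witness? : Decidable (λ x → Fixed Q x × tr x ≡ 0# × ¬ tr (α * x) ≡ 0#)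
        witness? x = fixed? Q x ×-dec ((tr x ≟ 0#) ×-dec ¬? (tr (α * x) ≟ 0#))
        vanishing : ¬ KernelWitness → ∀ {x} → Fixed Q x → tr x ≡ 0# → tr (α * x) ≡ 0#
        vanishing no-witness {x} x^Q≡x tr≡0 =
          decidable-stable (tr (α * x) ≟ 0#) (λ tr-α*≢0 → no-witness (x , x^Q≡x , tr≡0 , tr-α*≢0))

    -- On the kernel of tr, g is the GF(q)-linear functional tr (α x), which is nonzero there.
    witness⇒fixed-q⇒image : KernelWitness → ∀ {y} → Fixed q y → Image y
    witness⇒fixed-q⇒image (x₀ , x₀^Q≡x₀ , tr-x₀≡0 , d≢0) {y} y^q≡y = c * x₀ , fixed-* Q (fixed-q⇒fixed-Q c^q≡c) x₀^Q≡x₀ , g[cx₀]≡y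
      where
        d d⁻¹ c : Carrier
        d = tr (α * x₀)
        d⁻¹ = proj₁ (inverse d d≢0)
        c = y * d⁻¹
        c^q≡c : Fixed q c
        c^q≡c = fixed-* q y^q≡y (fixed-inverse q (tr-fixed-q (fixed-* Q α^Q≡α x₀^Q≡x₀)) d≢0 (proj₂ (inverse d d≢0)))
        tr-cx₀≡0 : tr (c * x₀) ≡ 0#
        tr-cx₀≡0 = trans (tr-linear c^q≡c x₀) (trans (cong (c *_) tr-x₀≡0) (zeroʳ c))
        g[cx₀]≡y : g (c * x₀) ≡ y
        g[cx₀]≡y = begin
          tr (c * x₀) * tr (c * x₀) + tr (α * (c * x₀))
            ≡⟨ cong₂ _+_ (trans (cong (_* tr (c * x₀)) tr-cx₀≡0) (zeroˡ _))
                         (cong tr (solve 3 (λ a c x → (a :* (c :* x)) := (c :* (a :* x))) refl α c x₀)) ⟩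
          0# + tr (c * (α * x₀))
            ≡⟨ trans (+-identityˡ _) (tr-linear c^q≡c (α * x₀)) ⟩
          y * d⁻¹ * d
            ≡⟨ trans (*-assoc y d⁻¹ d) (cong (y *_) (*-comm d⁻¹ d)) ⟩
          y * (d * d⁻¹)
            ≡⟨ trans (cong (y *_) (proj₂ (inverse d d≢0))) (*-identityʳ y) ⟩
          y ∎
          where open ≡-Reasoning

    fixed-q⇒image : ∀ {y} → Fixed q y → Image y
    fixed-q⇒image = witness⇒fixed-q⇒image kernel-witness

    count-fibre≡r : ∀ {y} → Fixed q y → count (fibre? y) ≡ r
    count-fibre≡r y^q≡y = trans (count-fibre (fixed-q⇒image y^q≡y)) (ℕ.*-cancelʳ-≡ _ r q (begin
      count kernel? ℕ.* q                   ≡⟨ cong (count kernel? ℕ.*_) (sym count-image) ⟩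
      count kernel? ℕ.* count image?        ≡⟨ sym count-domain≡kernel*image ⟩
      count (fixed? Q)                      ≡⟨ proj₁ TraceOntoSubfield.count-fixed-Q-and-image ⟩
      Q                                     ≡⟨ Q≡r*q ⟩
      r ℕ.* q                               ∎))
      where
        open ≡-Reasoning
        count-image : count image? ≡ q
        count-image = trans (length-filter-cong image? (fixed? q) (image⊆fixed-q , fixed-q⇒image) elements) TraceOntoFq.count-fixed-q

  Tr≡tr∘trQ : ∀ y → Tr₄ₘ y ≡ tr (trQ y)
  Tr≡tr∘trQ y = begin
    sumTo (4 ℕ.* m) (conjugate y)
      ≡⟨ cong (λ n → sumTo n (conjugate y)) 4m≡2m+2m ⟩
    sumTo (2 ℕ.* m ℕ.+ 2 ℕ.* m) (conjugate y)
      ≡⟨ sumTo-split (2 ℕ.* m) (2 ℕ.* m) (conjugate y) ⟩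
    tr y + sumTo (2 ℕ.* m) (λ i → conjugate y (2 ℕ.* m ℕ.+ i))
      ≡⟨ cong (tr y +_) (sumTo-cong (2 ℕ.* m) (λ i _ → conjugate-+ y (2 ℕ.* m) i)) ⟩
    tr y + tr (y ^ Q)
      ≡⟨ trans (+-comm _ _) (sym (tr-additive (y ^ Q) y)) ⟩
    tr (trQ y) ∎
    where open ≡-Reasoning

  St-4m-fixed-Q : ∀ {x} → Fixed Q x → St₄ₘ x ≡ tr x * tr x
  St-4m-fixed-Q {x} x^Q≡x = begin
    e₂ (4 ℕ.* m) (conjugate x)
      ≡⟨ cong (λ n → e₂ n (conjugate x)) 4m≡2m+2m ⟩
    e₂ (2 ℕ.* m ℕ.+ 2 ℕ.* m) (conjugate x)
      ≡⟨ e₂-split (2 ℕ.* m) (2 ℕ.* m) (conjugate x) ⟩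
    (e₂ (2 ℕ.* m) (conjugate x) + e₂ (2 ℕ.* m) shifted) + tr x * sumTo (2 ℕ.* m) shifted
      ≡⟨ cong₂ (λ u v → (e₂ (2 ℕ.* m) (conjugate x) + u) + tr x * v)
          (e₂-cong (2 ℕ.* m) shifted≡) (sumTo-cong (2 ℕ.* m) (λ i _ → shifted≡ i)) ⟩
    (e₂ (2 ℕ.* m) (conjugate x) + e₂ (2 ℕ.* m) (conjugate x)) + tr x * tr x
      ≡⟨ trans (cong (_+ tr x * tr x) (x+x≡0 _)) (+-identityˡ _) ⟩
    tr x * tr x ∎
    where
      open ≡-Reasoning
      shifted = λ i → conjugate x (2 ℕ.* m ℕ.+ i)
      shifted≡ : ∀ i → shifted i ≡ conjugate x i
      shifted≡ i = trans (conjugate-+ x (2 ℕ.* m) i) (cong (λ z → conjugate z i) x^Q≡x)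

  St-4m-fixed-q : ∀ γ → Fixed q (St₄ₘ γ)
  St-4m-fixed-q γ = begin
    e₂ (4 ℕ.* m) (conjugate γ) ^ q                       ≡⟨ e₂-^ q frobenius-q (4 ℕ.* m) (conjugate γ) ⟩
    e₂ (4 ℕ.* m) (λ i → conjugate γ i ^ q)               ≡⟨ e₂-cong (4 ℕ.* m) (conjugate-suc γ) ⟩
    e₂ (4 ℕ.* m) (λ i → conjugate γ (suc i))             ≡⟨ cong (λ n → e₂ n (λ i → conjugate γ (suc i))) 4m≡1+[4m∸1] ⟩
    e₂ (suc (4 ℕ.* m ∸ 1)) (λ i → conjugate γ (suc i))   ≡⟨ e₂-rotate (4 ℕ.* m ∸ 1) (conjugate γ) conjugate-4m≡γ ⟩
    e₂ (suc (4 ℕ.* m ∸ 1)) (conjugate γ)                 ≡⟨ cong (λ n → e₂ n (conjugate γ)) (sym 4m≡1+[4m∸1]) ⟩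
    e₂ (4 ℕ.* m) (conjugate γ)                           ∎
    where
      open ≡-Reasoning
      4m≡1+[4m∸1] : 4 ℕ.* m ≡ suc (4 ℕ.* m ∸ 1)
      4m≡1+[4m∸1] = trans (sym (ℕ.m∸n+n≡m (ℕ.≤-trans m≥1 (ℕ.m≤m+n m _)))) (ℕ.+-comm _ 1)
      conjugate-4m≡γ : conjugate γ (suc (4 ℕ.* m ∸ 1)) ≡ conjugate γ 0
      conjugate-4m≡γ = trans (cong (conjugate γ) (sym 4m≡1+[4m∸1])) (trans (cong (γ ^_) (sym order≡)) (trans (^-order γ) (sym (^-1 γ))))

  module SolutionCount (t s α : Carrier) (s^q≡s : Fixed q s) (α^Q≡α : Fixed Q α) (α∉Fq : ¬ Fixed q α) where

    open QuadraticForm α α^Q≡α α∉Fq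

    R : Pred Carrier 0ℓ
    R γ = trQ γ ≡ α × (Tr₄ₘ γ ≡ t × St₄ₘ γ ≡ s)

    R? : Decidable R
    R? γ = (trQ γ ≟ α) ×-dec ((Tr₄ₘ γ ≟ t) ×-dec (St₄ₘ γ ≟ s))

    γ₀ : Carrier
    γ₀ = proj₁ (TraceOntoSubfield.fixed-Q⇒image α^Q≡α)

    trQ-γ₀≡α : trQ γ₀ ≡ α
    trQ-γ₀≡α = proj₂ (proj₂ (TraceOntoSubfield.fixed-Q⇒image α^Q≡α))

    Tr-on-R : ∀ {γ} → trQ γ ≡ α → Tr₄ₘ γ ≡ tr α
    Tr-on-R {γ} trQ-γ≡α = trans (Tr≡tr∘trQ γ) (cong tr trQ-γ≡α)

    St-shift : ∀ {x} → Fixed Q x → St₄ₘ (γ₀ + x) ≡ St₄ₘ γ₀ + g x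
    St-shift {x} x^Q≡x = begin
      e₂ (4 ℕ.* m) (conjugate (γ₀ + x))
        ≡⟨ e₂-cong (4 ℕ.* m) (λ i → frobenius i γ₀ x) ⟩
      e₂ (4 ℕ.* m) (λ i → conjugate γ₀ i + conjugate x i)
        ≡⟨ e₂-+ (4 ℕ.* m) (conjugate γ₀) (conjugate x) ⟩
      ((St₀ + St₄ₘ x) + Tr₄ₘ γ₀ * Tr₄ₘ x) + sumTo (4 ℕ.* m) (λ i → conjugate γ₀ i * conjugate x i)
        ≡⟨ cong₂ _+_ (cong₂ _+_ (cong (St₀ +_) (St-4m-fixed-Q x^Q≡x)) Tr₀*Tr-x≡0) Σ≡tr-αx ⟩
      ((St₀ + tr x * tr x) + 0#) + tr (α * x)
        ≡⟨ trans (cong (_+ tr (α * x)) (+-identityʳ _)) (+-assoc _ _ _) ⟩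
      St₀ + g x ∎
      where
        open ≡-Reasoning
        St₀ = St₄ₘ γ₀
        Tr₀*Tr-x≡0 : Tr₄ₘ γ₀ * Tr₄ₘ x ≡ 0#
        Tr₀*Tr-x≡0 = trans (cong (Tr₄ₘ γ₀ *_) (trans (Tr≡tr∘trQ x) (trans (cong tr (trQ-fixed-Q x^Q≡x)) (additive-0 tr-additive)))) (zeroʳ _)
        trQ-γ₀x≡αx : trQ (γ₀ * x) ≡ α * x
        trQ-γ₀x≡αx = begin
          (γ₀ * x) ^ Q + γ₀ * x       ≡⟨ cong (_+ γ₀ * x) (trans (*-^ γ₀ x Q) (cong (γ₀ ^ Q *_) x^Q≡x)) ⟩
          γ₀ ^ Q * x + γ₀ * x         ≡⟨ sym (distribʳ x (γ₀ ^ Q) γ₀) ⟩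
          trQ γ₀ * x                  ≡⟨ cong (_* x) trQ-γ₀≡α ⟩
          α * x                       ∎
        Σ≡tr-αx : sumTo (4 ℕ.* m) (λ i → conjugate γ₀ i * conjugate x i) ≡ tr (α * x)
        Σ≡tr-αx = trans (sumTo-cong (4 ℕ.* m) (λ i _ → sym (*-^ γ₀ x (q ℕ.^ i)))) (trans (Tr≡tr∘trQ (γ₀ * x)) (cong tr trQ-γ₀x≡αx))

    count-R≡0 : ¬ t ≡ tr α → count R? ≡ 0
    count-R≡0 t≢tr-α = length-filter-none R? (λ (trQ≡α , Tr≡t , _) → t≢tr-α (trans (sym Tr≡t) (Tr-on-R trQ≡α))) elements

    -- Translating by γ₀ identifies R_α with the subfield of order Q and turns St into St γ₀ + g.
    count-R≡r : t ≡ tr α → count R? ≡ r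
    count-R≡r t≡tr-α = begin
      count R?
        ≡⟨ sym (count-∘ R?) ⟩
      count (λ x → R? (x + γ₀))
        ≡⟨ length-filter-cong _ (fibre? (St₀ + s)) (shifted⇒fibre , fibre⇒shifted) elements ⟩
      count (fibre? (St₀ + s))
        ≡⟨ count-fibre≡r (fixed-+ q frobenius-q (St-4m-fixed-q γ₀) s^q≡s) ⟩
      r ∎
      where
        open ≡-Reasoning
        open Bijection {_+ γ₀} {_+ γ₀} (λ x → x+y+y≡x x γ₀) (λ x → x+y+y≡x x γ₀)
        St₀ = St₄ₘ γ₀
        trQ-shift : ∀ x → trQ (x + γ₀) ≡ trQ x + α
        trQ-shift x = trans (trQ-additive x γ₀) (cong (trQ x +_) trQ-γ₀≡α)
        shifted⇒fibre : ∀ {x} → R (x + γ₀) → Fixed Q x × g x ≡ St₀ + s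
        shifted⇒fibre {x} (trQ≡α , _ , St≡s) =
          x^Q≡x , x+y≡z⇒x≡y+z (trans (+-comm (g x) St₀) (trans (sym (St-shift x^Q≡x)) (trans (cong St₄ₘ (+-comm γ₀ x)) St≡s)))
          where
            x^Q≡x : Fixed Q x
            x^Q≡x = x+y≡0⇒x≡y (trans (sym (x+y+y≡x (trQ x) α)) (trans (cong (_+ α) (trans (sym (trQ-shift x)) trQ≡α)) (x+x≡0 α)))
        fibre⇒shifted : ∀ {x} → Fixed Q x × g x ≡ St₀ + s → R (x + γ₀)
        fibre⇒shifted {x} (x^Q≡x , gx≡) = trQ≡α , trans (Tr-on-R trQ≡α) (sym t≡tr-α) , (begin
          St₄ₘ (x + γ₀)        ≡⟨ cong (St₄ₘ) (+-comm x γ₀) ⟩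
          St₄ₘ (γ₀ + x)        ≡⟨ St-shift x^Q≡x ⟩
          St₀ + g x                      ≡⟨ cong (St₀ +_) gx≡ ⟩
          St₀ + (St₀ + s)                ≡⟨ sym (+-assoc _ _ _) ⟩
          (St₀ + St₀) + s                ≡⟨ trans (cong (_+ s) (x+x≡0 St₀)) (+-identityˡ s) ⟩
          s                              ∎)
          where
            trQ≡α : trQ (x + γ₀) ≡ α
            trQ≡α = trans (trQ-shift x) (trans (cong (_+ α) (trQ-fixed-Q x^Q≡x)) (+-identityˡ α))

open import Data.Nat using (_≥_; _*_; _^_)

lemma8 : (k m : ℕ) → k ≥ 1 → m ≥ 1 →
    (K : FiniteField) → FiniteField.order K ≡ (2 ^ k) ^ (4 * m) →
    (t s α : FiniteField.Carrier K) → FiniteField.InSub K (2 ^ k) 1 t → FiniteField.InSub K (2 ^ k) 1 s →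
       FiniteField.InSub K (2 ^ k) (2 * m) α → ¬ FiniteField.InSub K (2 ^ k) 1 α →
       (t ≡ FiniteField.Tr K (2 ^ k) (2 * m) α → FiniteField.F K (2 ^ k) m (4 * m) t s α ≡ (2 ^ k) ^ (2 * m ∸ 1)) ×
       (¬ t ≡ FiniteField.Tr K (2 ^ k) (2 * m) α → FiniteField.F K (2 ^ k) m (4 * m) t s α ≡ 0)
lemma8 k m k≥1 m≥1 K order≡ t s α _ s∈GF[q] α∈GF[Q] α∉GF[q] = count-R≡r , count-R≡0
  where
    open FieldOfOrderQ² K k m k≥1 m≥1 order≡
    open FieldProperties K using (Fixed)
    GF[q]≡Fixed-q : ∀ x → FiniteField.InSub K q 1 x ≡ Fixed q x
    GF[q]≡Fixed-q x = cong (λ e → Fixed e x) (ℕ.^-identityʳ q)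
    open SolutionCount t s α (subst id (GF[q]≡Fixed-q s) s∈GF[q]) α∈GF[Q]
                             (α∉GF[q] ∘ subst id (sym (GF[q]≡Fixed-q α)))
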